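{- Let $(W,S)$ be a Coxeter system with $W$ finite. Then for each $k\ge 0$, the number of Boolean intervals of rank $k$ in the right weak order of $W$ is $$\frac{i_k(\Gamma_W)\cdot |W|}{2^k},$$ where $i_k(\Gamma_W)$ is the number of independent sets of size $k$ of the Coxeter graph $\Gamma_W$.
   Context: The Coxeter graph $\Gamma_W$ has vertex set $S$ and an edge between $s,s'$ iff the order $m(s,s')$ of $ss'$ is at least $3$. The right weak order on $W$: $u\le w$ iff $\ell(w)=\ell(u)+\ell(u^{ -1}w)$, with $\ell$ Coxeter length. An interval is Boolean of rank $k$ if it is isomorphic to the lattice of subsets of a $k$-element set. -}

module Defs where

open import Level using (0ℓ)
open import Algebra.Bundles using (Group)
open import Data.Nat using (ℕ; zero; suc; _+_; _≤_; _<_)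
open import Data.Fin using (Fin)
open import Data.Fin.Subset using (Subset; _∈_; _⊆_; ∣_∣)
open import Data.List using (List; []; _∷_; length; foldr)
open import Data.List.Relation.Unary.All using (All)
open import Data.List.Relation.Unary.Any using (Any)
open import Data.List.Relation.Unary.AllPairs using (AllPairs)
open import Data.Product using (Σ; ∃; _×_; _,_; proj₁; proj₂)
open import Relation.Nullary using (¬_)
open import Relation.Binary.PropositionalEquality using (_≡_; _≢_)
open import Relation.Binary.Definitions using (Decidable)

gpow : (G : Group 0ℓ 0ℓ) → Group.Carrier G → ℕ → Group.Carrier G
gpow G x zero    = Group.ε G
gpow G x (suc m) = Group._∙_ G x (gpow G x m)

-- Everything is relative to a group W (with setoid equality _≈_) and
-- a family s : Fin n → W of candidate Coxeter generators (S = image of s).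
module Cox (W : Group 0ℓ 0ℓ) {n : ℕ} (s : Fin n → Group.Carrier W) where
  open Group W

  pow : Carrier → ℕ → Carrier
  pow = gpow W

  eval : List (Fin n) → Carrier
  eval = foldr (λ i acc → s i ∙ acc) ε

  -- (W , S) is a Coxeter system: S = {s i} is a set of n distinct
  -- involutions generating W, and W is presented by the generators s i
  -- subject to the relations (s i s j)^{m(i,j)} = 1, m(i,j) = order of s i s j
  -- (universal property of the presentation).
  record IsCoxeterSystem : Set₁ where
    field
      injective   : ∀ i j → s i ≈ s j → i ≡ j
      nontrivial  : ∀ i → ¬ (s i ≈ ε)
      involution  : ∀ i → s i ∙ s i ≈ ε
      generates   : ∀ w → ∃ λ (xs : List (Fin n)) → eval xs ≈ w
      universal   : (G : Group 0ℓ 0ℓ) (g : Fin n → Group.Carrier G) →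
        (∀ i j m → pow (s i ∙ s j) m ≈ ε →
           Group._≈_ G (gpow G (Group._∙_ G (g i) (g j)) m) (Group.ε G)) →
        Σ (Carrier → Group.Carrier G) λ φ →
          (∀ x y → x ≈ y → Group._≈_ G (φ x) (φ y)) ×
          (∀ x y → Group._≈_ G (φ (x ∙ y)) (Group._∙_ G (φ x) (φ y))) ×
          (∀ i → Group._≈_ G (φ (s i)) (g i))

  -- W is finite: E lists every element exactly once (up to ≈); |W| = length E
  IsEnumeration : List Carrier → Set
  IsEnumeration E = AllPairs (λ x y → ¬ (x ≈ y)) E × (∀ w → Any (w ≈_) E)

  HasLength : Carrier → ℕ → Set
  HasLength w k =
    (∃ λ (xs : List (Fin n)) → length xs ≡ k × eval xs ≈ w) ×
    (∀ (xs : List (Fin n)) → eval xs ≈ w → k ≤ length xs)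

  _≤R_ : Carrier → Carrier → Set
  u ≤R w = ∃ λ a → ∃ λ b → ∃ λ c →
    HasLength w a × HasLength u b × HasLength (u ⁻¹ ∙ w) c × a ≡ b + c

  -- the interval [u , w] is Boolean of rank k: there is an order isomorphism
  -- from (Subset k , ⊆) onto {v | u ≤R v ≤R w} (order embedding + surjective)
  IsBooleanInterval : ℕ → Carrier → Carrier → Set
  IsBooleanInterval k u w =
    Σ (Subset k → Carrier) λ f →
      (∀ A → u ≤R f A × f A ≤R w) ×
      (∀ A B → (f A ≤R f B → A ⊆ B) × (A ⊆ B → f A ≤R f B)) ×
      (∀ v → u ≤R v → v ≤R w → ∃ λ A → v ≈ f A)

  CountsBooleanIntervals : ℕ → List (Carrier × Carrier) → Set
  CountsBooleanIntervals k L =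
    AllPairs (λ p q → ¬ (proj₁ p ≈ proj₁ q × proj₂ p ≈ proj₂ q)) L ×
    All (λ p → IsBooleanInterval k (proj₁ p) (proj₂ p)) L ×
    (∀ u w → IsBooleanInterval k u w → Any (λ p → u ≈ proj₁ p × w ≈ proj₂ p) L)

  OrderAtLeast3 : Carrier → Set
  OrderAtLeast3 x = ∀ m → 1 ≤ m → m < 3 → ¬ (pow x m ≈ ε)

  Edge : Fin n → Fin n → Set
  Edge i j = OrderAtLeast3 (s i ∙ s j)

  IsIndependentSet : ℕ → Subset n → Set
  IsIndependentSet k A = ∣ A ∣ ≡ k × (∀ i j → i ∈ A → j ∈ A → ¬ Edge i j)

  CountsIndependentSets : ℕ → List (Subset n) → Set
  CountsIndependentSets k I =
    AllPairs _≢_ I × All (IsIndependentSet k) I ×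
    (∀ A → IsIndependentSet k A → Any (A ≡_) I)

-- The Boolean intervals of rank k in the right weak order are exactly the intervals
-- [u , u w₀ J] where J is an independent set of k vertices of the Coxeter graph, so that
-- the generators in J commute and w₀ J is their product, and u has no right descent in J;
-- A ↦ u ∏_{j ∈ A} s_j is then the lattice isomorphism.  Conversely, the atoms of a Boolean
-- interval [u , w] are u s_j for k distinct generators, any two of which commute because
-- they are the two left descents of an element of length 2, and u⁻¹ w is their product.
-- For fixed J, right multiplication by s_j (j ∈ J) exchanges the elements with and without
-- right descent s_j and preserves the other descents in J, so exactly |W| / 2^k elements u
-- have no right descent in J.  Lengths, descents and the exchange property come from the
-- presentation of W through the reflection cocycle of Bourbaki.

module Submission where

open import Defs
open import Level using (0ℓ)
open import Algebra.Bundles using (Group)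
open import Data.Nat using (ℕ; _*_; _^_)
open import Data.Fin using (Fin)
open import Data.Fin.Subset using (Subset)
open import Data.List using (List; length)
open import Data.Product using (Σ; _×_; _,_; proj₁; proj₂)
open import Relation.Binary.PropositionalEquality using (_≡_)
open import Relation.Binary.Definitions using (Decidable)

module Preliminaries where

  open import Data.Bool using (true; false; _xor_)
  open import Data.Bool.Properties using (xor-same; xor-assoc)
  open import Data.Nat using (zero; suc; _+_; _≤_; _<_; z≤n; s≤s)
  open import Data.Nat.Properties
    using (≤-refl; ≤-trans; ≤-reflexive; ≤-antisym; ≤-pred; m≤n⇒m<n∨m≡n; +-suc; suc-injective; +-monoʳ-≤;
           n≤1+n; 1+n≰n; module ≤-Reasoning)
  open import Data.Fin using (zero; suc; _≟_)
  import Data.Fin.Properties as Fin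
  open import Data.List using ([]; _∷_; map; filter; cartesianProductWith)
  open import Data.List.Properties using (length-map)
  open import Data.List.Membership.Propositional using () renaming (_∈_ to _∈ₚ_)
  open import Data.List.Membership.Propositional.Properties using (∈-cartesianProductWith⁺)
  open import Data.List.Relation.Unary.Unique.Propositional using () renaming (Unique to UniqueP)
  import Data.List.Relation.Unary.Unique.Propositional.Properties as UniqueP
  open import Data.List.Relation.Unary.All using (All; []; _∷_)
  import Data.List.Relation.Unary.All as All
  open import Data.List.Relation.Unary.Any using (here; there)
  open import Data.List.Relation.Unary.AllPairs using (AllPairs; []; _∷_)
  open import Data.Vec using ([]; _∷_; lookup; zipWith; here; there)
  open import Data.Vec.Properties using (∷-injective; lookup-zipWith; lookup⇒[]=; []=⇒lookup)
  open import Data.Product using (∃)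
  open import Data.Sum using (_⊎_; inj₁; inj₂)
  open import Data.Empty using (⊥-elim)
  open import Relation.Nullary using (¬_; yes; no)
  open import Relation.Unary using (Pred)
  import Relation.Unary as U
  open import Relation.Unary.Properties using (_∩?_; ∁?)
  open import Relation.Binary.Bundles using (Setoid)
  open import Relation.Binary.PropositionalEquality as P using (_≢_)

  module _ {P : Pred ℕ 0ℓ} (P? : U.Decidable P) where

    private
      least-upTo : ∀ m → (∃ λ k → P k × ∀ j → j < k → ¬ P j) ⊎ (∀ j → j ≤ m → ¬ P j)
      least-upTo zero with P? zero
      ... | yes p = inj₁ (zero , p , λ _ ())
      ... | no ¬p = inj₂ λ { zero _ → ¬p }
      least-upTo (suc m) with least-upTo m
      ... | inj₁ w = inj₁ w
      ... | inj₂ none with P? (suc m)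
      ...   | yes p = inj₁ (suc m , p , λ j j<1+m → none j (≤-pred j<1+m))
      ...   | no ¬p = inj₂ λ j j≤1+m → case (m≤n⇒m<n∨m≡n j≤1+m)
        where
        case : ∀ {j} → j < suc m ⊎ j ≡ suc m → ¬ P j
        case (inj₁ j<1+m) = none _ (≤-pred j<1+m)
        case (inj₂ P.refl) = ¬p

    least-witness : ∀ {m} → P m → ∃ λ k → P k × ∀ j → j < k → ¬ P j
    least-witness {m} p with least-upTo m
    ... | inj₁ w = w
    ... | inj₂ none = ⊥-elim (none m ≤-refl p)

  module DuplicateFree (S : Setoid 0ℓ 0ℓ) where
    open Setoid S
    open import Data.List.Membership.Setoid S using (_∈_)
    open import Data.List.Membership.Setoid.Properties using (∈-filter⁺; ∈-filter⁻; ∈-map⁻; ∈-resp-≈; All[≉]⇒∉)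
    open import Data.List.Relation.Unary.Unique.Setoid S using (Unique)
    import Data.List.Relation.Unary.Unique.Setoid.Properties as Unique
    open import Data.List.Relation.Binary.Subset.Setoid S using (_⊆_)

    remove : ∀ {x} xs → x ∈ xs → List Carrier
    remove (_ ∷ xs) (here _) = xs
    remove (y ∷ xs) (there x∈xs) = y ∷ remove xs x∈xs

    length-remove : ∀ {x} xs (x∈xs : x ∈ xs) → suc (length (remove xs x∈xs)) ≡ length xs
    length-remove (_ ∷ xs) (here _) = P.refl
    length-remove (y ∷ xs) (there x∈xs) = P.cong suc (length-remove xs x∈xs)

    ∈-remove⁺ : ∀ {x z} xs (x∈xs : x ∈ xs) → z ∈ xs → ¬ z ≈ x → z ∈ remove xs x∈xs
    ∈-remove⁺ (y ∷ xs) (here x≈y) (here z≈y) z≉x = ⊥-elim (z≉x (trans z≈y (sym x≈y)))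
    ∈-remove⁺ (y ∷ xs) (here _) (there z∈xs) _ = z∈xs
    ∈-remove⁺ (y ∷ xs) (there _) (here z≈y) _ = here z≈y
    ∈-remove⁺ (y ∷ xs) (there x∈xs) (there z∈xs) z≉x = there (∈-remove⁺ xs x∈xs z∈xs z≉x)

    Unique-⊆⇒length≤ : ∀ {xs ys} → Unique xs → xs ⊆ ys → length xs ≤ length ys
    Unique-⊆⇒length≤ {[]} _ _ = z≤n
    Unique-⊆⇒length≤ {x ∷ xs} {ys} (x≉xs ∷ xs!) xs⊆ys =
      ≤-trans (s≤s (Unique-⊆⇒length≤ xs! xs⊆ys-x)) (≤-reflexive (length-remove ys x∈ys))
      where
      x∈ys : x ∈ ys
      x∈ys = xs⊆ys (here refl)
      z≉x : ∀ {z} → z ∈ xs → ¬ z ≈ x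
      z≉x z∈xs z≈x = All[≉]⇒∉ S x≉xs (∈-resp-≈ S z≈x z∈xs)
      xs⊆ys-x : xs ⊆ remove ys x∈ys
      xs⊆ys-x z∈xs = ∈-remove⁺ ys x∈ys (xs⊆ys (there z∈xs)) (z≉x z∈xs)

    module _ {E : List Carrier} (E! : Unique E) (E-complete : ∀ x → x ∈ E)
             {σ : Carrier → Carrier} (σ-cong : ∀ {x y} → x ≈ y → σ x ≈ σ y) (σ-involutive : ∀ x → σ (σ x) ≈ x)
             {Q Q′ : Pred Carrier 0ℓ} (Q? : U.Decidable Q) (Q′? : U.Decidable Q′)
             (Q-resp : ∀ {x y} → x ≈ y → Q x → Q y) (Q′-resp : ∀ {x y} → x ≈ y → Q′ x → Q′ y) where

      private
        σ-injective : ∀ {x y} → σ x ≈ σ y → x ≈ y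
        σ-injective σx≈σy = trans (sym (σ-involutive _)) (trans (σ-cong σx≈σy) (σ-involutive _))

        length-filter-≤ : ∀ {A B : Pred Carrier 0ℓ} (A? : U.Decidable A) (B? : U.Decidable B) →
          (∀ {x y} → x ≈ y → A x → A y) → (∀ {x y} → x ≈ y → B x → B y) → (∀ {x} → A x → B (σ x)) →
          length (filter A? E) ≤ length (filter B? E)
        length-filter-≤ A? B? A-resp B-resp A⇒Bσ = begin
          length (filter A? E)         ≡⟨ P.sym (length-map σ (filter A? E)) ⟩
          length (map σ (filter A? E)) ≤⟨ Unique-⊆⇒length≤ (Unique.map⁺ S S σ-injective (Unique.filter⁺ S A? E!)) σ[A]⊆B ⟩
          length (filter B? E)         ∎
          where
          open ≤-Reasoning
          σ[A]⊆B : map σ (filter A? E) ⊆ filter B? E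
          σ[A]⊆B y∈ with ∈-map⁻ S S y∈
          ... | x , x∈ , y≈σx = ∈-filter⁺ S B? B-resp (E-complete _)
            (B-resp (sym y≈σx) (A⇒Bσ (proj₂ (∈-filter⁻ S A? A-resp {xs = E} x∈))))

      length-filter-swap : (∀ {x} → Q x → Q′ (σ x)) → (∀ {x} → Q′ x → Q (σ x)) →
        length (filter Q? E) ≡ length (filter Q′? E)
      length-filter-swap Q⇒Q′σ Q′⇒Qσ = ≤-antisym
        (length-filter-≤ Q? Q′? Q-resp Q′-resp Q⇒Q′σ) (length-filter-≤ Q′? Q? Q′-resp Q-resp Q′⇒Qσ)

  length-filter-split : ∀ {A : Set} {Q R : Pred A 0ℓ} (R? : U.Decidable R) (Q? : U.Decidable Q) xs →
    length (filter Q? xs) ≡ length (filter (R? ∩? Q?) xs) + length (filter (∁? R? ∩? Q?) xs)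
  length-filter-split R? Q? [] = P.refl
  length-filter-split R? Q? (x ∷ xs) with R? x | Q? x | length-filter-split R? Q? xs
  ... | yes _ | yes _ | eq = P.cong suc eq
  ... | no _  | yes _ | eq = P.trans (P.cong suc eq) (P.sym (+-suc _ _))
  ... | yes _ | no _  | eq = eq
  ... | no _  | no _  | eq = eq

  open import Data.Fin.Subset using (Subset; inside; outside; ⊥; ⊤; ⁅_⁆; ∣_∣; _∈_; _∉_; _⊆_)
  open import Data.Fin.Subset.Properties
    using (drop-∷-⊆; out⊆; in⊆in; ⊆-antisym; ⊆-min; x∈⁅x⁆; x∈⁅y⁆⇒x≡y; x≢y⇒x∉⁅y⁆; ∣⁅x⁆∣≡1)

  infixl 6 _⊕_

  _⊕_ : ∀ {k} → Subset k → Subset k → Subset k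
  _⊕_ = zipWith _xor_

  module _ {k : ℕ} where

    ∈⇒lookup : ∀ {A : Subset k} {x} → x ∈ A → lookup A x ≡ inside
    ∈⇒lookup = []=⇒lookup

    lookup⇒∈ : ∀ {A : Subset k} {x} → lookup A x ≡ inside → x ∈ A
    lookup⇒∈ {A} {x} = lookup⇒[]= x A

    lookup-⊕ : ∀ (A B : Subset k) x → lookup (A ⊕ B) x ≡ lookup A x xor lookup B x
    lookup-⊕ A B x = lookup-zipWith _xor_ x A B

    lookup-⁅⁆-≢ : ∀ {x y : Fin k} → y ≢ x → lookup ⁅ x ⁆ y ≡ outside
    lookup-⁅⁆-≢ {x} {y} y≢x with lookup ⁅ x ⁆ y in eq
    ... | false = P.refl
    ... | true = ⊥-elim (x≢y⇒x∉⁅y⁆ y≢x (lookup⇒∈ eq))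

    ⁅⁆⊆ : ∀ {A : Subset k} {x} → x ∈ A → ⁅ x ⁆ ⊆ A
    ⁅⁆⊆ x∈A y∈⁅x⁆ with x∈⁅y⁆⇒x≡y _ y∈⁅x⁆
    ... | P.refl = x∈A

  ⊕-self : ∀ {k} (A : Subset k) → A ⊕ A ≡ ⊥
  ⊕-self [] = P.refl
  ⊕-self (a ∷ A) = P.cong₂ _∷_ (xor-same a) (⊕-self A)

  ⊕-assoc : ∀ {k} (A B C : Subset k) → (A ⊕ B) ⊕ C ≡ A ⊕ (B ⊕ C)
  ⊕-assoc [] [] [] = P.refl
  ⊕-assoc (a ∷ A) (b ∷ B) (c ∷ C) = P.cong₂ _∷_ (xor-assoc a b c) (⊕-assoc A B C)

  ⊕-identityˡ : ∀ {k} (A : Subset k) → ⊥ ⊕ A ≡ A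
  ⊕-identityˡ [] = P.refl
  ⊕-identityˡ (a ∷ A) = P.cong (a ∷_) (⊕-identityˡ A)

  ∣∣≤∣∣+∣⊕∣ : ∀ {k} (A B : Subset k) → ∣ A ∣ ≤ ∣ B ∣ + ∣ B ⊕ A ∣
  ∣∣≤∣∣+∣⊕∣ [] [] = z≤n
  ∣∣≤∣∣+∣⊕∣ (true ∷ A) (true ∷ B) = s≤s (∣∣≤∣∣+∣⊕∣ A B)
  ∣∣≤∣∣+∣⊕∣ (true ∷ A) (false ∷ B) = ≤-trans (s≤s (∣∣≤∣∣+∣⊕∣ A B)) (≤-reflexive (P.sym (+-suc _ _)))
  ∣∣≤∣∣+∣⊕∣ (false ∷ A) (true ∷ B) =
    ≤-trans (∣∣≤∣∣+∣⊕∣ A B) (≤-trans (n≤1+n _) (s≤s (+-monoʳ-≤ ∣ B ∣ (n≤1+n _))))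
  ∣∣≤∣∣+∣⊕∣ (false ∷ A) (false ∷ B) = ∣∣≤∣∣+∣⊕∣ A B

  ⊆⇒∣∣≡∣∣+∣⊕∣ : ∀ {k} {A B : Subset k} → B ⊆ A → ∣ A ∣ ≡ ∣ B ∣ + ∣ B ⊕ A ∣
  ⊆⇒∣∣≡∣∣+∣⊕∣ {A = []} {[]} _ = P.refl
  ⊆⇒∣∣≡∣∣+∣⊕∣ {A = true ∷ A} {true ∷ B} B⊆A = P.cong suc (⊆⇒∣∣≡∣∣+∣⊕∣ (drop-∷-⊆ B⊆A))
  ⊆⇒∣∣≡∣∣+∣⊕∣ {A = true ∷ A} {false ∷ B} B⊆A =
    P.trans (P.cong suc (⊆⇒∣∣≡∣∣+∣⊕∣ (drop-∷-⊆ B⊆A))) (P.sym (+-suc _ _))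
  ⊆⇒∣∣≡∣∣+∣⊕∣ {A = false ∷ A} {false ∷ B} B⊆A = ⊆⇒∣∣≡∣∣+∣⊕∣ (drop-∷-⊆ B⊆A)
  ⊆⇒∣∣≡∣∣+∣⊕∣ {A = false ∷ A} {true ∷ B} B⊆A with B⊆A here
  ... | ()

  ∣∣≡∣∣+∣⊕∣⇒⊆ : ∀ {k} (A B : Subset k) → ∣ A ∣ ≡ ∣ B ∣ + ∣ B ⊕ A ∣ → B ⊆ A
  ∣∣≡∣∣+∣⊕∣⇒⊆ [] [] _ = λ ()
  ∣∣≡∣∣+∣⊕∣⇒⊆ (true ∷ A) (true ∷ B) eq = in⊆in (∣∣≡∣∣+∣⊕∣⇒⊆ A B (suc-injective eq))
  ∣∣≡∣∣+∣⊕∣⇒⊆ (true ∷ A) (false ∷ B) eq =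
    out⊆ (∣∣≡∣∣+∣⊕∣⇒⊆ A B (suc-injective (P.trans eq (+-suc _ _))))
  ∣∣≡∣∣+∣⊕∣⇒⊆ (false ∷ A) (false ∷ B) eq = out⊆ (∣∣≡∣∣+∣⊕∣⇒⊆ A B eq)
  ∣∣≡∣∣+∣⊕∣⇒⊆ (false ∷ A) (true ∷ B) eq = ⊥-elim (1+n≰n (begin
    suc (∣ B ∣ + ∣ B ⊕ A ∣)       ≤⟨ s≤s (+-monoʳ-≤ ∣ B ∣ (n≤1+n _)) ⟩
    suc (∣ B ∣ + suc ∣ B ⊕ A ∣)   ≡⟨ P.sym eq ⟩
    ∣ A ∣                         ≤⟨ ∣∣≤∣∣+∣⊕∣ A B ⟩
    ∣ B ∣ + ∣ B ⊕ A ∣             ∎))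
    where open ≤-Reasoning

  module _ {k : ℕ} {A : Subset k} {x : Fin k} (x∈A : x ∈ A) where

    private
      lookup-⁅⁆⊕-≢ : ∀ {y} → y ≢ x → lookup (⁅ x ⁆ ⊕ A) y ≡ lookup A y
      lookup-⁅⁆⊕-≢ {y} y≢x = P.trans (lookup-⊕ ⁅ x ⁆ A y) (P.cong (_xor lookup A y) (lookup-⁅⁆-≢ y≢x))

      x∉⁅x⁆⊕A : x ∉ ⁅ x ⁆ ⊕ A
      x∉⁅x⁆⊕A x∈ with P.trans (P.sym (∈⇒lookup x∈)) (lookup-⊕ ⁅ x ⁆ A x)
      ... | eq rewrite ∈⇒lookup (x∈⁅x⁆ x) | ∈⇒lookup x∈A with eq
      ... | ()

    ⁅⁆⊕⊆ : ⁅ x ⁆ ⊕ A ⊆ A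
    ⁅⁆⊕⊆ {y} y∈ with y ≟ x
    ... | yes P.refl = ⊥-elim (x∉⁅x⁆⊕A y∈)
    ... | no y≢x = lookup⇒∈ (P.trans (P.sym (lookup-⁅⁆⊕-≢ y≢x)) (∈⇒lookup y∈))

    ⁅⁆⊕≢ : ⁅ x ⁆ ⊕ A ≢ A
    ⁅⁆⊕≢ eq = x∉⁅x⁆⊕A (P.subst (x ∈_) (P.sym eq) x∈A)

    ⁅⁆⊕-covered : ∀ {C} → ⁅ x ⁆ ⊕ A ⊆ C → C ⊆ A → C ≡ ⁅ x ⁆ ⊕ A ⊎ C ≡ A
    ⁅⁆⊕-covered {C} A-x⊆C C⊆A with lookup C x in eq
    ... | true = inj₂ (⊆-antisym C⊆A A⊆C)
      where
      A⊆C : A ⊆ C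
      A⊆C {y} y∈A with y ≟ x
      ... | yes P.refl = lookup⇒∈ eq
      ... | no y≢x = A-x⊆C (lookup⇒∈ (P.trans (lookup-⁅⁆⊕-≢ y≢x) (∈⇒lookup y∈A)))
    ... | false = inj₁ (⊆-antisym C⊆A-x A-x⊆C)
      where
      C⊆A-x : C ⊆ ⁅ x ⁆ ⊕ A
      C⊆A-x {y} y∈C with y ≟ x
      ... | yes P.refl with P.trans (P.sym (∈⇒lookup y∈C)) eq
      ...   | ()
      C⊆A-x {y} y∈C | no y≢x = lookup⇒∈ (P.trans (lookup-⁅⁆⊕-≢ y≢x) (∈⇒lookup (C⊆A y∈C)))

    ∣⁅⁆⊕∣ : ∣ A ∣ ≡ suc ∣ ⁅ x ⁆ ⊕ A ∣
    ∣⁅⁆⊕∣ = P.trans (⊆⇒∣∣≡∣∣+∣⊕∣ (⁅⁆⊆ x∈A)) (P.cong (_+ ∣ ⁅ x ⁆ ⊕ A ∣) (∣⁅x⁆∣≡1 x))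

  ∣∣≡0⇒≡⊥ : ∀ {k} (A : Subset k) → ∣ A ∣ ≡ 0 → A ≡ ⊥
  ∣∣≡0⇒≡⊥ [] _ = P.refl
  ∣∣≡0⇒≡⊥ (false ∷ A) eq = P.cong (false ∷_) (∣∣≡0⇒≡⊥ A eq)

  ∣∣≡suc⇒nonempty : ∀ {k m} (A : Subset k) → ∣ A ∣ ≡ suc m → ∃ λ x → x ∈ A
  ∣∣≡suc⇒nonempty (true ∷ A) _ = zero , here
  ∣∣≡suc⇒nonempty (false ∷ A) eq with ∣∣≡suc⇒nonempty A eq
  ... | x , x∈A = suc x , there x∈A

  module _ {k : ℕ} {x y : Fin k} (x≢y : x ≢ y) where

    ⁅⁆⊆⁅⁆⊕⁅⁆ˡ : ⁅ x ⁆ ⊆ ⁅ x ⁆ ⊕ ⁅ y ⁆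
    ⁅⁆⊆⁅⁆⊕⁅⁆ˡ = ⁅⁆⊆ (lookup⇒∈ (P.trans (lookup-⊕ ⁅ x ⁆ ⁅ y ⁆ x)
      (P.cong₂ _xor_ (∈⇒lookup (x∈⁅x⁆ x)) (lookup-⁅⁆-≢ x≢y))))

    ∣⁅⁆⊕⁅⁆∣ : ∣ ⁅ x ⁆ ⊕ ⁅ y ⁆ ∣ ≡ 2
    ∣⁅⁆⊕⁅⁆∣ = begin
      ∣ ⁅ x ⁆ ⊕ ⁅ y ⁆ ∣                     ≡⟨ ⊆⇒∣∣≡∣∣+∣⊕∣ ⁅⁆⊆⁅⁆⊕⁅⁆ˡ ⟩
      ∣ ⁅ x ⁆ ∣ + ∣ ⁅ x ⁆ ⊕ (⁅ x ⁆ ⊕ ⁅ y ⁆) ∣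
        ≡⟨ P.cong₂ (λ a B → a + ∣ B ∣) (∣⁅x⁆∣≡1 x) ⁅x⁆⊕⁅x⁆⊕⁅y⁆ ⟩
      1 + ∣ ⁅ y ⁆ ∣                          ≡⟨ P.cong suc (∣⁅x⁆∣≡1 y) ⟩
      2                                      ∎
      where
      open P.≡-Reasoning
      ⁅x⁆⊕⁅x⁆⊕⁅y⁆ : ⁅ x ⁆ ⊕ (⁅ x ⁆ ⊕ ⁅ y ⁆) ≡ ⁅ y ⁆
      ⁅x⁆⊕⁅x⁆⊕⁅y⁆ = P.trans (P.sym (⊕-assoc ⁅ x ⁆ ⁅ x ⁆ ⁅ y ⁆))
        (P.trans (P.cong (_⊕ ⁅ y ⁆) (⊕-self ⁅ x ⁆)) (⊕-identityˡ ⁅ y ⁆))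

    ⁅⁆⊆⁅⁆⊕⁅⁆ʳ : ⁅ y ⁆ ⊆ ⁅ x ⁆ ⊕ ⁅ y ⁆
    ⁅⁆⊆⁅⁆⊕⁅⁆ʳ = ⁅⁆⊆ (lookup⇒∈ (P.trans (lookup-⊕ ⁅ x ⁆ ⁅ y ⁆ y)
      (P.cong₂ _xor_ (lookup-⁅⁆-≢ (λ y≡x → x≢y (P.sym y≡x))) (∈⇒lookup (x∈⁅x⁆ y)))))

  elements : ∀ {k} (A : Subset k) → Fin ∣ A ∣ → Fin k
  elements (true ∷ A) zero = zero
  elements (true ∷ A) (suc p) = suc (elements A p)
  elements (false ∷ A) p = suc (elements A p)

  elements-∈ : ∀ {k} (A : Subset k) p → elements A p ∈ A
  elements-∈ (true ∷ A) zero = here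
  elements-∈ (true ∷ A) (suc p) = there (elements-∈ A p)
  elements-∈ (false ∷ A) p = there (elements-∈ A p)

  elements-injective : ∀ {k} (A : Subset k) {p q} → elements A p ≡ elements A q → p ≡ q
  elements-injective (true ∷ A) {zero} {zero} _ = P.refl
  elements-injective (true ∷ A) {suc p} {suc q} eq = P.cong suc (elements-injective A (Fin.suc-injective eq))
  elements-injective (false ∷ A) eq = elements-injective A (Fin.suc-injective eq)

  elements-surjective : ∀ {k} (A : Subset k) {x} → x ∈ A → ∃ λ p → elements A p ≡ x
  elements-surjective (true ∷ A) here = zero , P.refl
  elements-surjective (true ∷ A) (there x∈A) with elements-surjective A x∈A
  ... | p , P.refl = suc p , P.refl
  elements-surjective (false ∷ A) (there x∈A) with elements-surjective A x∈A
  ... | p , P.refl = p , P.refl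

  allSubsets : ∀ k → List (Subset k)
  allSubsets zero = [] ∷ []
  allSubsets (suc k) = cartesianProductWith _∷_ (inside ∷ outside ∷ []) (allSubsets k)

  allSubsets-complete : ∀ {k} (A : Subset k) → A ∈ₚ allSubsets k
  allSubsets-complete [] = here P.refl
  allSubsets-complete (a ∷ A) = ∈-cartesianProductWith⁺ _∷_ (Bool-complete a) (allSubsets-complete A)
    where
    Bool-complete : ∀ b → b ∈ₚ inside ∷ outside ∷ []
    Bool-complete true = here P.refl
    Bool-complete false = there (here P.refl)

  allSubsets-unique : ∀ k → UniqueP (allSubsets k)
  allSubsets-unique zero = [] ∷ []
  allSubsets-unique (suc k) = UniqueP.cartesianProductWith⁺ _∷_ ∷-injective
    (((λ ()) ∷ []) ∷ [] ∷ []) (allSubsets-unique k)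

  select : ∀ {k} {B : Set} → Subset k → (Fin k → B) → List B
  select [] f = []
  select (true ∷ A) f = f zero ∷ select A (λ p → f (suc p))
  select (false ∷ A) f = select A (λ p → f (suc p))

  module _ {B : Set} where

    select-⊥ : ∀ {k} (f : Fin k → B) → select ⊥ f ≡ []
    select-⊥ {zero} f = P.refl
    select-⊥ {suc k} f = select-⊥ (λ p → f (suc p))

    select-⁅⁆ : ∀ {k} (f : Fin k → B) p → select ⁅ p ⁆ f ≡ f p ∷ []
    select-⁅⁆ {suc k} f zero = P.cong (f zero ∷_) (select-⊥ (λ p → f (suc p)))
    select-⁅⁆ {suc k} f (suc p) = select-⁅⁆ (λ p → f (suc p)) p

    ∈-select⁻ : ∀ {k} (A : Subset k) (f : Fin k → B) {b} → b ∈ₚ select A f → ∃ λ p → p ∈ A × f p ≡ b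
    ∈-select⁻ (true ∷ A) f (here P.refl) = zero , here , P.refl
    ∈-select⁻ (true ∷ A) f (there b∈) with ∈-select⁻ A (λ p → f (suc p)) b∈
    ... | p , p∈A , fp≡b = suc p , there p∈A , fp≡b
    ∈-select⁻ (false ∷ A) f b∈ with ∈-select⁻ A (λ p → f (suc p)) b∈
    ... | p , p∈A , fp≡b = suc p , there p∈A , fp≡b

    All-select : ∀ {k} {Q : Pred B 0ℓ} (A : Subset k) (f : Fin k → B) → (∀ p → Q (f p)) → All Q (select A f)
    All-select [] f Qf = []
    All-select (true ∷ A) f Qf = Qf zero ∷ All-select A (λ p → f (suc p)) (λ p → Qf (suc p))
    All-select (false ∷ A) f Qf = All-select A (λ p → f (suc p)) (λ p → Qf (suc p))

    AllPairs-select : ∀ {k} {R : B → B → Set} (A : Subset k) (f : Fin k → B) →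
      (∀ {p q} → p ≢ q → R (f p) (f q)) → AllPairs R (select A f)
    AllPairs-select [] f Rf = []
    AllPairs-select (true ∷ A) f Rf =
      All-select A (λ p → f (suc p)) (λ p → Rf λ ()) ∷
      AllPairs-select A (λ p → f (suc p)) (λ p≢q → Rf λ eq → p≢q (Fin.suc-injective eq))
    AllPairs-select (false ∷ A) f Rf = AllPairs-select A (λ p → f (suc p)) (λ p≢q → Rf λ eq → p≢q (Fin.suc-injective eq))

  ∣∣≡-enumerated : ∀ {k m} {J : Subset m} (f : Fin k → Fin m) → (∀ {p q} → f p ≡ f q → p ≡ q) →
    (∀ p → f p ∈ J) → (∀ {x} → x ∈ J → ∃ λ p → f p ≡ x) → ∣ J ∣ ≡ k
  ∣∣≡-enumerated {J = J} f f-injective f∈J f-onto = Fin.cantor-schröder-bernstein {f = to-f} {g = to-elements}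
    (λ {q} {q′} eq → elements-injective J (P.trans (P.sym (proj₂ (f-onto (elements-∈ J q))))
      (P.trans (P.cong f eq) (proj₂ (f-onto (elements-∈ J q′))))))
    (λ {p} {p′} eq → f-injective (P.trans (P.sym (proj₂ (elements-surjective J (f∈J p))))
      (P.trans (P.cong (elements J) eq) (proj₂ (elements-surjective J (f∈J p′))))))
    where
    to-f : Fin ∣ J ∣ → Fin _
    to-f q = proj₁ (f-onto (elements-∈ J q))
    to-elements : Fin _ → Fin ∣ J ∣
    to-elements p = proj₁ (elements-surjective J (f∈J p))

  AllPairs-All⁺ : ∀ {A : Set} {P : Pred A 0ℓ} {R S : A → A → Set} → (∀ {x y} → P x → P y → R x y → S x y) →
    ∀ {xs} → All P xs → AllPairs R xs → AllPairs S xs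
  AllPairs-All⁺ f [] [] = []
  AllPairs-All⁺ f (px ∷ pxs) (rx ∷ rxs) = All.zipWith (λ (py , r) → f px py r) (pxs , rx) ∷ AllPairs-All⁺ f pxs rxs

module Coxeter (W : Group 0ℓ 0ℓ) {n : ℕ} (s : Fin n → Group.Carrier W)
               (cox : Cox.IsCoxeterSystem W s) (_≈?_ : Decidable (Group._≈_ W)) where

  open import Function using (_∘_)
  open import Data.Bool using (Bool; true; false; not; _xor_)
  open import Data.Bool.Properties using (xor-same; xor-assoc; xor-identityʳ; not-¬; ¬-not)
  import Data.Bool.Properties as Bool
  open import Data.Nat using (zero; suc; _+_; _≤_; _<_; z≤n; s≤s)
  open import Data.Nat.Properties
  open import Data.Fin using (zero; suc)
  import Data.Fin.Properties as Fin
  open import Data.Fin.Subset using (⊥; ⊤; ⁅_⁆; ∣_∣; _∈_; _⊆_)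
  open import Data.Fin.Subset.Properties
    using (_∈?_; ⊆-min; ⊆⊤; ⊆-antisym; ∈⊤; ∣⊤∣≡n; x∈⁅x⁆; x∈⁅y⁆⇒x≡y; ∣⁅x⁆∣≡1)
  open import Data.Vec using ([]; _∷_)
  import Data.Vec as Vec
  open import Data.Vec.Properties using (lookup∘tabulate)
  open import Data.List using ([]; _∷_; [_]; _++_; _∷ʳ_; reverse; filter; map; concatMap)
  open import Data.List.Properties using (length-++; length-reverse; unfold-reverse; filter-all; filter-≐; length-map)
  open import Data.List.Membership.Propositional using () renaming (_∈_ to _∈ₚ_)
  open import Data.List.Membership.Propositional.Properties using (∈-filter⁺)
  open import Data.List.Membership.Setoid.Properties using () renaming (∈-filter⁺ to ∈-filterˢ⁺)
  open import Data.List.Relation.Unary.Any using (Any; here; there)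
  import Data.List.Relation.Unary.Any as Any
  import Data.List.Relation.Unary.Any.Properties as Any
  open import Data.List.Relation.Unary.All using (All; []; _∷_)
  import Data.List.Relation.Unary.All as All
  import Data.List.Relation.Unary.All.Properties as All
  open import Data.List.Relation.Unary.All.Properties using (all-filter)
  open import Data.List.Relation.Unary.AllPairs using (AllPairs; []; _∷_)
  import Data.List.Relation.Unary.AllPairs as AllPairs
  import Data.List.Relation.Unary.AllPairs.Properties as AllPairs
  open import Data.Product using (∃)
  open import Data.Sum using (_⊎_; inj₁; inj₂)
  open import Data.Empty using (⊥-elim)
  open import Relation.Nullary using (¬_; Dec; yes; no; does)
  open import Relation.Nullary.Decidable using (_×-dec_; _→-dec_; ¬?)
  open import Relation.Unary using (_∩_)
  import Relation.Unary as U
  open import Relation.Unary.Properties using (_∩?_; ∁?)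
  open import Relation.Binary.PropositionalEquality as P using (_≢_)

  open Group W
  open Cox W s
  open Cox.IsCoxeterSystem cox renaming (injective to s-injective)
  open import Algebra.Properties.Group W
    using (ε⁻¹≈ε; ⁻¹-involutive; ⁻¹-anti-homo-∙; inverseˡ-unique; \\-leftDividesˡ; \\-leftDividesʳ)
  open import Algebra.Properties.Monoid monoid using (cancelˡ; cancelʳ)
  open import Relation.Binary.Reasoning.Setoid setoid using (begin_; _∎; step-≈-⟩; step-≈-⟨)

  open Preliminaries

  s∙s∙x≈x : ∀ i x → s i ∙ (s i ∙ x) ≈ x
  s∙s∙x≈x i = cancelˡ (involution i)

  x∙s∙s≈x : ∀ i x → (x ∙ s i) ∙ s i ≈ x
  x∙s∙s≈x i = cancelʳ (involution i)

  s⁻¹≈s : ∀ i → s i ⁻¹ ≈ s i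
  s⁻¹≈s i = sym (inverseˡ-unique (s i) (s i) (involution i))

  eval-++ : ∀ xs ys → eval (xs ++ ys) ≈ eval xs ∙ eval ys
  eval-++ [] ys = sym (identityˡ _)
  eval-++ (i ∷ xs) ys = begin
    s i ∙ eval (xs ++ ys)      ≈⟨ ∙-congˡ (eval-++ xs ys) ⟩
    s i ∙ (eval xs ∙ eval ys)  ≈⟨ assoc _ _ _ ⟨
    (s i ∙ eval xs) ∙ eval ys  ∎

  eval-reverse : ∀ xs → eval (reverse xs) ≈ eval xs ⁻¹
  eval-reverse [] = sym ε⁻¹≈ε
  eval-reverse (i ∷ xs) = begin
    eval (reverse (i ∷ xs))         ≈⟨ reflexive (P.cong eval (unfold-reverse i xs)) ⟩
    eval (reverse xs ∷ʳ i)          ≈⟨ eval-++ (reverse xs) [ i ] ⟩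
    eval (reverse xs) ∙ (s i ∙ ε)   ≈⟨ ∙-cong (eval-reverse xs) (identityʳ _) ⟩
    eval xs ⁻¹ ∙ s i                ≈⟨ ∙-congˡ (s⁻¹≈s i) ⟨
    eval xs ⁻¹ ∙ s i ⁻¹             ≈⟨ ⁻¹-anti-homo-∙ _ _ ⟨
    (s i ∙ eval xs) ⁻¹              ∎

  HasWordOfLength : ℕ → Carrier → Set
  HasWordOfLength m w = ∃ λ xs → length xs ≡ m × eval xs ≈ w

  hasWordOfLength? : ∀ m w → Dec (HasWordOfLength m w)
  hasWordOfLength? zero w with ε ≈? w
  ... | yes ε≈w = yes ([] , P.refl , ε≈w)
  ... | no ε≉w = no λ { ([] , _ , ε≈w) → ε≉w ε≈w }
  hasWordOfLength? (suc m) w with Fin.any? (λ i → hasWordOfLength? m (s i ∙ w))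
  ... | yes (i , xs , len , xs≈sw) = yes (i ∷ xs , P.cong suc len , (begin
    s i ∙ eval xs       ≈⟨ ∙-congˡ xs≈sw ⟩
    s i ∙ (s i ∙ w)     ≈⟨ s∙s∙x≈x i w ⟩
    w                   ∎))
  ... | no none = no λ { (i ∷ xs , len , ixs≈w) → none (i , xs , suc-injective len , (begin
    eval xs             ≈⟨ s∙s∙x≈x i _ ⟨
    s i ∙ (s i ∙ eval xs) ≈⟨ ∙-congˡ ixs≈w ⟩
    s i ∙ w             ∎)) }

  abstract
    shortestWord : ∀ w → ∃ λ m → HasWordOfLength m w × ∀ j → j < m → ¬ HasWordOfLength j w
    shortestWord w with generates w
    ... | xs , xs≈w = least-witness (λ m → hasWordOfLength? m w) (xs , P.refl , xs≈w)

  ℓ : Carrier → ℕ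
  ℓ w = proj₁ (shortestWord w)

  reducedWord : Carrier → List (Fin n)
  reducedWord w = proj₁ (proj₁ (proj₂ (shortestWord w)))

  length-reducedWord : ∀ w → length (reducedWord w) ≡ ℓ w
  length-reducedWord w = proj₁ (proj₂ (proj₁ (proj₂ (shortestWord w))))

  eval-reducedWord : ∀ w → eval (reducedWord w) ≈ w
  eval-reducedWord w = proj₂ (proj₂ (proj₁ (proj₂ (shortestWord w))))

  ℓ-minimal : ∀ w xs → eval xs ≈ w → ℓ w ≤ length xs
  ℓ-minimal w xs xs≈w = ≮⇒≥ λ shorter → proj₂ (proj₂ (shortestWord w)) _ shorter (xs , P.refl , xs≈w)

  HasLength-ℓ : ∀ w → HasLength w (ℓ w)
  HasLength-ℓ w = (reducedWord w , length-reducedWord w , eval-reducedWord w) , ℓ-minimal w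

  HasLength⇒≡ℓ : ∀ {w k} → HasLength w k → k ≡ ℓ w
  HasLength⇒≡ℓ {w} ((xs , len , xs≈w) , minimal) = ≤-antisym
    (≤-trans (minimal (reducedWord w) (eval-reducedWord w)) (≤-reflexive (length-reducedWord w)))
    (≤-trans (ℓ-minimal w xs xs≈w) (≤-reflexive len))

  ℓ-cong : ∀ {x y} → x ≈ y → ℓ x ≡ ℓ y
  ℓ-cong {x} {y} x≈y = ≤-antisym
    (≤-trans (ℓ-minimal x (reducedWord y) (trans (eval-reducedWord y) (sym x≈y))) (≤-reflexive (length-reducedWord y)))
    (≤-trans (ℓ-minimal y (reducedWord x) (trans (eval-reducedWord x) x≈y)) (≤-reflexive (length-reducedWord x)))

  ℓ-∙ : ∀ x y → ℓ (x ∙ y) ≤ ℓ x + ℓ y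
  ℓ-∙ x y = ≤-trans
    (ℓ-minimal (x ∙ y) (reducedWord x ++ reducedWord y)
      (trans (eval-++ (reducedWord x) (reducedWord y)) (∙-cong (eval-reducedWord x) (eval-reducedWord y))))
    (≤-reflexive (P.trans (length-++ (reducedWord x)) (P.cong₂ _+_ (length-reducedWord x) (length-reducedWord y))))

  ℓ-⁻¹ : ∀ x → ℓ (x ⁻¹) ≡ ℓ x
  ℓ-⁻¹ x = ≤-antisym (ℓ-⁻¹-≤ x) (≤-trans (≤-reflexive (ℓ-cong (sym (⁻¹-involutive x)))) (ℓ-⁻¹-≤ (x ⁻¹)))
    where
    ℓ-⁻¹-≤ : ∀ x → ℓ (x ⁻¹) ≤ ℓ x
    ℓ-⁻¹-≤ x = ≤-trans
      (ℓ-minimal (x ⁻¹) (reverse (reducedWord x)) (trans (eval-reverse (reducedWord x)) (⁻¹-cong (eval-reducedWord x))))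
      (≤-reflexive (P.trans (length-reverse (reducedWord x)) (length-reducedWord x)))

  ℓ-ε : ℓ ε ≡ 0
  ℓ-ε = n≤0⇒n≡0 (ℓ-minimal ε [] refl)

  ℓ≡0⇒≈ε : ∀ {x} → ℓ x ≡ 0 → x ≈ ε
  ℓ≡0⇒≈ε {x} ℓx≡0 with reducedWord x | length-reducedWord x | eval-reducedWord x
  ... | [] | _ | ε≈x = sym ε≈x
  ... | _ ∷ _ | len | _ with P.trans len ℓx≡0
  ... | ()

  ℓ≡1⇒≈s : ∀ {x} → ℓ x ≡ 1 → ∃ λ i → x ≈ s i
  ℓ≡1⇒≈s {x} ℓx≡1 with reducedWord x | length-reducedWord x | eval-reducedWord x
  ... | i ∷ [] | _ | si∙ε≈x = i , sym (trans (sym (identityʳ _)) si∙ε≈x)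
  ... | [] | len | _ with P.trans len ℓx≡1
  ...   | ()
  ℓ≡1⇒≈s {x} ℓx≡1 | _ ∷ _ ∷ _ | len | _ with P.trans len ℓx≡1
  ...   | ()

  ℓ-s : ∀ i → ℓ (s i) ≡ 1
  ℓ-s i with ℓ (s i) in eq
  ... | zero = ⊥-elim (nontrivial i (ℓ≡0⇒≈ε eq))
  ... | suc zero = P.refl
  ... | suc (suc _) = ⊥-elim (<⇒≱ (s≤s (s≤s z≤n)) (≤-trans (≤-reflexive (P.sym eq)) (ℓ-minimal (s i) [ i ] (identityʳ _))))

  ℓ-s∙ : ∀ i w → ℓ (s i ∙ w) ≤ suc (ℓ w)
  ℓ-s∙ i w = ≤-trans (ℓ-∙ (s i) w) (≤-reflexive (P.cong (_+ ℓ w) (ℓ-s i)))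

  ℓ-∙s : ∀ i w → ℓ (w ∙ s i) ≤ suc (ℓ w)
  ℓ-∙s i w = ≤-trans (ℓ-∙ w (s i)) (≤-reflexive (P.trans (P.cong (ℓ w +_) (ℓ-s i)) (+-comm (ℓ w) 1)))

  -- Reflection parities of words

  _≈ᵇ_ : Carrier → Carrier → Bool
  a ≈ᵇ b = does (a ≈? b)

  ≈ᵇ-≡ : ∀ {a b c d} → (a ≈ b → c ≈ d) → (c ≈ d → a ≈ b) → a ≈ᵇ b ≡ c ≈ᵇ d
  ≈ᵇ-≡ {a} {b} {c} {d} to from with a ≈? b | c ≈? d
  ... | yes _ | yes _ = P.refl
  ... | no _ | no _ = P.refl
  ... | yes a≈b | no c≉d = ⊥-elim (c≉d (to a≈b))
  ... | no a≉b | yes c≈d = ⊥-elim (a≉b (from c≈d))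

  ≈ᵇ-respˡ : ∀ {a a′ b} → a ≈ a′ → a ≈ᵇ b ≡ a′ ≈ᵇ b
  ≈ᵇ-respˡ a≈a′ = ≈ᵇ-≡ (trans (sym a≈a′)) (trans a≈a′)

  ≈⇒≈ᵇ : ∀ {a b} → a ≈ b → a ≈ᵇ b ≡ true
  ≈⇒≈ᵇ {a} {b} a≈b with a ≈? b
  ... | yes _ = P.refl
  ... | no a≉b = ⊥-elim (a≉b a≈b)

  ≉⇒≈ᵇ : ∀ {a b} → ¬ a ≈ b → a ≈ᵇ b ≡ false
  ≉⇒≈ᵇ {a} {b} a≉b with a ≈? b
  ... | yes a≈b = ⊥-elim (a≉b a≈b)
  ... | no _ = P.refl

  conj : Fin n → Carrier → Carrier
  conj i t = (s i ∙ t) ∙ s i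

  conj-cong : ∀ i {t t′} → t ≈ t′ → conj i t ≈ conj i t′
  conj-cong i t≈t′ = ∙-congʳ (∙-congˡ t≈t′)

  conj-involutive : ∀ i t → conj i (conj i t) ≈ t
  conj-involutive i t = begin
    (s i ∙ ((s i ∙ t) ∙ s i)) ∙ s i  ≈⟨ ∙-congʳ (assoc _ _ _) ⟨
    ((s i ∙ (s i ∙ t)) ∙ s i) ∙ s i  ≈⟨ x∙s∙s≈x i _ ⟩
    s i ∙ (s i ∙ t)                  ≈⟨ s∙s∙x≈x i t ⟩
    t                                ∎

  -- For xs = i₁ ⋯ iₘ, parity xs t says whether t ≈ s_{i₁}⋯s_{iₚ₋₁} s_{iₚ} s_{iₚ₋₁}⋯s_{i₁}
  -- for an odd number of positions p.
  parity : List (Fin n) → Carrier → Bool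
  parity [] t = false
  parity (i ∷ xs) t = (t ≈ᵇ s i) xor parity xs (conj i t)

  parity-resp : ∀ xs {t t′} → t ≈ t′ → parity xs t ≡ parity xs t′
  parity-resp [] _ = P.refl
  parity-resp (i ∷ xs) t≈t′ = P.cong₂ _xor_ (≈ᵇ-respˡ t≈t′) (parity-resp xs (conj-cong i t≈t′))

  -- Following Bourbaki, the words act
  -- on W × (W → Bool) through a group W ⋉ (W → Bool); the presentation of W makes this
  -- action factor through W, and the second component of the action of xs is parity xs.
  module _ where
    open import Algebra.Structures using (IsGroup)
    import Algebra.Properties.Group as GroupProperties

    private
      record Marking : Set where
        constructor marking
        field
          mark : Carrier → Bool
          mark-resp : ∀ {x y} → x ≈ y → mark x ≡ mark y
      open Marking

      Ŵ : Set
      Ŵ = Carrier × Marking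

      conjBy : Carrier → Carrier → Carrier
      conjBy g t = (g ⁻¹ ∙ t) ∙ g

      conjBy-cong : ∀ {g g′ t t′} → g ≈ g′ → t ≈ t′ → conjBy g t ≈ conjBy g′ t′
      conjBy-cong g≈g′ t≈t′ = ∙-cong (∙-cong (⁻¹-cong g≈g′) t≈t′) g≈g′

      conjBy-∙ : ∀ g h t → conjBy (g ∙ h) t ≈ conjBy h (conjBy g t)
      conjBy-∙ g h t = begin
        ((g ∙ h) ⁻¹ ∙ t) ∙ (g ∙ h)        ≈⟨ ∙-congʳ (∙-congʳ (⁻¹-anti-homo-∙ g h)) ⟩
        ((h ⁻¹ ∙ g ⁻¹) ∙ t) ∙ (g ∙ h)     ≈⟨ ∙-congʳ (assoc _ _ _) ⟩
        (h ⁻¹ ∙ (g ⁻¹ ∙ t)) ∙ (g ∙ h)     ≈⟨ assoc _ _ _ ⟨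
        ((h ⁻¹ ∙ (g ⁻¹ ∙ t)) ∙ g) ∙ h     ≈⟨ ∙-congʳ (assoc _ _ _) ⟩
        (h ⁻¹ ∙ ((g ⁻¹ ∙ t) ∙ g)) ∙ h     ∎

      conjBy-ε : ∀ t → conjBy ε t ≈ t
      conjBy-ε t = trans (identityʳ _) (trans (∙-congʳ ε⁻¹≈ε) (identityˡ t))

      conjBy-⁻¹ : ∀ g t → conjBy (g ⁻¹) (conjBy g t) ≈ t
      conjBy-⁻¹ g t = begin
        (g ⁻¹ ⁻¹ ∙ ((g ⁻¹ ∙ t) ∙ g)) ∙ g ⁻¹  ≈⟨ ∙-congʳ (∙-congʳ (⁻¹-involutive g)) ⟩
        (g ∙ ((g ⁻¹ ∙ t) ∙ g)) ∙ g ⁻¹        ≈⟨ ∙-congʳ (assoc _ _ _) ⟨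
        ((g ∙ (g ⁻¹ ∙ t)) ∙ g) ∙ g ⁻¹        ≈⟨ ∙-congʳ (∙-congʳ (\\-leftDividesˡ g t)) ⟩
        (t ∙ g) ∙ g ⁻¹                       ≈⟨ assoc _ _ _ ⟩
        t ∙ (g ∙ g ⁻¹)                       ≈⟨ ∙-congˡ (inverseʳ g) ⟩
        t ∙ ε                                ≈⟨ identityʳ t ⟩
        t                                    ∎

      conjBy-s : ∀ i t → conjBy (s i) t ≈ conj i t
      conjBy-s i t = ∙-congʳ (∙-congʳ (s⁻¹≈s i))

      infix 4 _≈̂_
      infixl 7 _∙̂_
      record _≈̂_ (a b : Ŵ) : Set where
        constructor _,_
        field
          ≈̂-fst : proj₁ a ≈ proj₁ b
          ≈̂-snd : ∀ t → mark (proj₂ a) t ≡ mark (proj₂ b) t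
      open _≈̂_

      _∙̂_ : Ŵ → Ŵ → Ŵ
      (g , f) ∙̂ (h , f′) = g ∙ h , marking (λ t → mark f t xor mark f′ (conjBy g t))
        (λ t≈t′ → P.cong₂ _xor_ (mark-resp f t≈t′) (mark-resp f′ (conjBy-cong refl t≈t′)))

      ε̂ : Ŵ
      ε̂ = ε , marking (λ _ → false) (λ _ → P.refl)

      _⁻¹̂ : Ŵ → Ŵ
      (g , f) ⁻¹̂ = g ⁻¹ , marking (λ t → mark f (conjBy (g ⁻¹) t)) (λ t≈t′ → mark-resp f (conjBy-cong refl t≈t′))

      Ŵ-isGroup : IsGroup _≈̂_ _∙̂_ ε̂ _⁻¹̂
      Ŵ-isGroup = record
        { isMonoid = record
          { isSemigroup = record
            { isMagma = record
              { isEquivalence = record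
                { refl = refl , λ _ → P.refl
                ; sym = λ (e , f) → sym e , λ t → P.sym (f t)
                ; trans = λ (e , f) (e′ , f′) → trans e e′ , λ t → P.trans (f t) (f′ t) }
              ; ∙-cong = λ { {_ , f} {g′ , _} {_ , k} (e , fe) (e′ , ke) →
                  ∙-cong e e′ , λ t → P.cong₂ _xor_ (fe t) (P.trans (mark-resp k (conjBy-cong e refl)) (ke (conjBy g′ t))) } }
            ; assoc = λ (g , f) (h , f′) (_ , f″) → assoc g h _ , λ t →
                P.trans (xor-assoc (mark f t) _ _)
                  (P.cong (λ b → mark f t xor (mark f′ (conjBy g t) xor b)) (mark-resp f″ (conjBy-∙ g h t))) }
          ; identity = (λ (g , f) → identityˡ g , λ t → mark-resp f (conjBy-ε t))
                     , (λ (g , f) → identityʳ g , λ t → xor-identityʳ (mark f t)) }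
        ; inverse = (λ (g , f) → inverseˡ g , λ t → xor-same (mark f (conjBy (g ⁻¹) t)))
                  , (λ (g , f) → inverseʳ g , λ t → P.trans (P.cong (mark f t xor_) (mark-resp f (conjBy-⁻¹ g t))) (xor-same (mark f t)))
        ; ⁻¹-cong = λ { {g , f} (e , fe) → ⁻¹-cong e , λ t → P.trans (mark-resp f (conjBy-cong (⁻¹-cong e) refl)) (fe _) } }

      Ŵ-group : Group 0ℓ 0ℓ
      Ŵ-group = record { isGroup = Ŵ-isGroup }
      module Ŵ = Group Ŵ-group

      ŝ : Fin n → Ŵ
      ŝ i = s i , marking (_≈ᵇ s i) ≈ᵇ-respˡ

      evalŴ : List (Fin n) → Ŵ
      evalŴ [] = ε̂
      evalŴ (i ∷ xs) = ŝ i ∙̂ evalŴ xs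

      evalŴ≈ : ∀ xs → evalŴ xs ≈̂ (eval xs , marking (parity xs) (parity-resp xs))
      evalŴ≈ [] = Ŵ.refl
      evalŴ≈ (i ∷ xs) = Ŵ.trans (Ŵ.∙-cong {ŝ i} Ŵ.refl (evalŴ≈ xs))
        (refl , λ t → P.cong ((t ≈ᵇ s i) xor_) (parity-resp xs (conjBy-s i t)))

      alternating : Fin n → Fin n → ℕ → List (Fin n)
      alternating i j zero = []
      alternating i j (suc m) = i ∷ j ∷ alternating i j m

      eval-alternating : ∀ i j m → eval (alternating i j m) ≈ pow (s i ∙ s j) m
      eval-alternating i j zero = refl
      eval-alternating i j (suc m) = trans (sym (assoc _ _ _)) (∙-congˡ (eval-alternating i j m))

      evalŴ-alternating : ∀ i j m → gpow Ŵ-group (ŝ i ∙̂ ŝ j) m ≈̂ evalŴ (alternating i j m)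
      evalŴ-alternating i j zero = Ŵ.refl
      evalŴ-alternating i j (suc m) =
        Ŵ.trans (Ŵ.∙-cong {ŝ i ∙̂ ŝ j} Ŵ.refl (evalŴ-alternating i j m)) (Ŵ.assoc (ŝ i) (ŝ j) (evalŴ (alternating i j m)))

      xorSum : (ℕ → Bool) → ℕ → Bool
      xorSum ρ zero = false
      xorSum ρ (suc m) = ρ 0 xor xorSum (λ c → ρ (suc c)) m

      xorSum-cong : ∀ {ρ ρ′} → (∀ c → ρ c ≡ ρ′ c) → ∀ m → xorSum ρ m ≡ xorSum ρ′ m
      xorSum-cong eq zero = P.refl
      xorSum-cong eq (suc m) = P.cong₂ _xor_ (eq 0) (xorSum-cong (λ c → eq (suc c)) m)

      xorSum-+ : ∀ ρ a b → xorSum ρ (a + b) ≡ xorSum ρ a xor xorSum (λ c → ρ (a + c)) b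
      xorSum-+ ρ zero b = P.refl
      xorSum-+ ρ (suc a) b = P.trans (P.cong (ρ 0 xor_) (xorSum-+ (λ c → ρ (suc c)) a b)) (P.sym (xor-assoc (ρ 0) _ _))

      double : ℕ → ℕ
      double zero = zero
      double (suc m) = suc (suc (double m))

      xorSum-periodic : ∀ ρ m → (∀ c → ρ (m + c) ≡ ρ c) → xorSum ρ (double m) ≡ false
      xorSum-periodic ρ m periodic =
        P.trans (P.cong (xorSum ρ) (double≡ m)) (P.trans (xorSum-+ ρ m m)
          (P.trans (P.cong (xorSum ρ m xor_) (xorSum-cong periodic m)) (xor-same (xorSum ρ m))))
        where
        double≡ : ∀ m → double m ≡ m + m
        double≡ zero = P.refl
        double≡ (suc m) = P.cong suc (P.trans (P.cong suc (double≡ m)) (P.sym (+-suc m m)))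

      pow-comm : ∀ x c → x ∙ pow x c ≈ pow x c ∙ x
      pow-comm x zero = trans (identityʳ x) (sym (identityˡ x))
      pow-comm x (suc c) = trans (∙-congˡ (pow-comm x c)) (sym (assoc _ _ _))

      pow-+ : ∀ x a b → pow x (a + b) ≈ pow x a ∙ pow x b
      pow-+ x zero b = sym (identityˡ _)
      pow-+ x (suc a) b = trans (∙-congˡ (pow-+ x a b)) (sym (assoc _ _ _))

      -- The reflections met along (s i s j)^m are y 0, y 1, …, y (2m-1) with y c = (s i s j)^c s i;
      -- if (s i s j)^m = 1 they occur in pairs, so the parity vanishes.
      module Alternating (i j : Fin n) where
        x = s i ∙ s j

        y : ℕ → Carrier
        y c = pow x c ∙ s i

        atY : Carrier → ℕ → Bool
        atY t c = t ≈ᵇ y c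

        conj-conj-y : ∀ c → conj i (conj j (y c)) ≈ y (suc (suc c))
        conj-conj-y c = begin
          (s i ∙ ((s j ∙ (pow x c ∙ s i)) ∙ s j)) ∙ s i  ≈⟨ ∙-congʳ (∙-congˡ (assoc _ _ _)) ⟩
          (s i ∙ (s j ∙ ((pow x c ∙ s i) ∙ s j))) ∙ s i  ≈⟨ ∙-congʳ (assoc _ _ _) ⟨
          (x ∙ ((pow x c ∙ s i) ∙ s j)) ∙ s i            ≈⟨ ∙-congʳ (∙-congˡ (assoc _ _ _)) ⟩
          (x ∙ (pow x c ∙ x)) ∙ s i                      ≈⟨ ∙-congʳ (∙-congˡ (pow-comm x c)) ⟨
          (x ∙ (x ∙ pow x c)) ∙ s i                      ∎

        s≈y0 : s i ≈ y 0
        s≈y0 = sym (identityˡ _)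

        conj-s≈y1 : conj i (s j) ≈ y 1
        conj-s≈y1 = ∙-congʳ (sym (identityʳ _))

        atY-shift : ∀ t c → atY (conj j (conj i t)) c ≡ atY t (suc (suc c))
        atY-shift t c = ≈ᵇ-≡
          (λ e → trans (sym (conj-involutive i t))
                   (trans (conj-cong i (trans (sym (conj-involutive j (conj i t))) (conj-cong j e))) (conj-conj-y c)))
          (λ e → trans (conj-cong j (conj-cong i e)) (trans (conj-cong j (conj-cong i (sym (conj-conj-y c))))
                   (trans (conj-cong j (conj-involutive i _)) (conj-involutive j _))))

        parity-alternating : ∀ m t → parity (alternating i j m) t ≡ xorSum (atY t) (double m)
        parity-alternating zero t = P.refl
        parity-alternating (suc m) t = P.cong₂ _xor_
          (≈ᵇ-≡ (λ e → trans e s≈y0) (λ e → trans e (sym s≈y0)))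
          (P.cong₂ _xor_
            (≈ᵇ-≡ (λ e → trans (sym (conj-involutive i t)) (trans (conj-cong i e) conj-s≈y1))
                  (λ e → trans (conj-cong i e) (trans (conj-cong i (sym conj-s≈y1)) (conj-involutive i _))))
            (P.trans (parity-alternating m (conj j (conj i t))) (xorSum-cong (atY-shift t) (double m))))

        parity-alternating-relation : ∀ m → pow x m ≈ ε → ∀ t → parity (alternating i j m) t ≡ false
        parity-alternating-relation m xᵐ≈ε t = P.trans (parity-alternating m t)
          (xorSum-periodic (atY t) m λ c →
            ≈ᵇ-≡ (λ e → trans e (∙-congʳ (y-periodic c))) (λ e → trans e (∙-congʳ (sym (y-periodic c)))))
          where
          y-periodic : ∀ c → pow x (m + c) ≈ pow x c
          y-periodic c = trans (pow-+ x m c) (trans (∙-congʳ xᵐ≈ε) (identityˡ _))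

      relations : ∀ i j m → pow (s i ∙ s j) m ≈ ε → gpow Ŵ-group (ŝ i ∙̂ ŝ j) m ≈̂ ε̂
      relations i j m rel = Ŵ.trans (evalŴ-alternating i j m) (Ŵ.trans (evalŴ≈ (alternating i j m))
        (trans (eval-alternating i j m) rel , Alternating.parity-alternating-relation i j m rel))

      lift = universal Ŵ-group ŝ relations

      φ : Carrier → Ŵ
      φ = proj₁ lift

      φ-cong : ∀ {x y} → x ≈ y → φ x ≈̂ φ y
      φ-cong = proj₁ (proj₂ lift) _ _

      φ-∙ : ∀ x y → φ (x ∙ y) ≈̂ φ x ∙̂ φ y
      φ-∙ = proj₁ (proj₂ (proj₂ lift))

      φ-s : ∀ i → φ (s i) ≈̂ ŝ i
      φ-s = proj₂ (proj₂ (proj₂ lift))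

      φ-ε : φ ε ≈̂ ε̂
      φ-ε = GroupProperties.identityˡ-unique Ŵ-group (φ ε) (φ ε) (Ŵ.trans (Ŵ.sym (φ-∙ ε ε)) (φ-cong (identityˡ ε)))

      φ-eval : ∀ xs → φ (eval xs) ≈̂ evalŴ xs
      φ-eval [] = φ-ε
      φ-eval (i ∷ xs) = Ŵ.trans (φ-∙ (s i) (eval xs)) (Ŵ.∙-cong (φ-s i) (φ-eval xs))

    parity-invariant : ∀ xs ys → eval xs ≈ eval ys → ∀ t → parity xs t ≡ parity ys t
    parity-invariant xs ys xs≈ys = ≈̂-snd (Ŵ.trans (Ŵ.sym (evalŴ≈ xs)) (Ŵ.trans (Ŵ.sym (φ-eval xs))
      (Ŵ.trans (φ-cong xs≈ys) (Ŵ.trans (φ-eval ys) (evalŴ≈ ys)))))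

  -- Descents

  -- For a reflection t, inverts w t holds iff ℓ (t ∙ w) < ℓ w.
  inverts : Carrier → Carrier → Bool
  inverts w = parity (reducedWord w)

  inverts-word : ∀ {w} xs → eval xs ≈ w → ∀ t → inverts w t ≡ parity xs t
  inverts-word {w} xs xs≈w = parity-invariant (reducedWord w) xs (trans (eval-reducedWord w) (sym xs≈w))

  inverts-cong : ∀ {w w′} → w ≈ w′ → ∀ t → inverts w t ≡ inverts w′ t
  inverts-cong {w′ = w′} w≈w′ = inverts-word (reducedWord w′) (trans (eval-reducedWord w′) (sym w≈w′))

  inverts-resp : ∀ w {t t′} → t ≈ t′ → inverts w t ≡ inverts w t′
  inverts-resp w = parity-resp (reducedWord w)

  inverts-s∙ : ∀ i w t → inverts (s i ∙ w) t ≡ (t ≈ᵇ s i) xor inverts w (conj i t)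
  inverts-s∙ i w = inverts-word (i ∷ reducedWord w) (∙-congˡ (eval-reducedWord w))

  -- The exchange property in the form "deleting a letter"
  parity⇒shorter : ∀ xs t → parity xs t ≡ true →
    ∃ λ ys → suc (length ys) ≡ length xs × eval ys ≈ t ∙ eval xs
  parity⇒shorter (i ∷ xs) t odd with t ≈? s i
  ... | yes t≈s = xs , P.refl , sym (trans (∙-congʳ t≈s) (s∙s∙x≈x i _))
  ... | no _ with parity⇒shorter xs (conj i t) odd
  ... | ys , len , ys≈ = i ∷ ys , P.cong suc len , (begin
    s i ∙ eval ys                              ≈⟨ ∙-congˡ ys≈ ⟩
    s i ∙ (((s i ∙ t) ∙ s i) ∙ eval xs)        ≈⟨ ∙-congˡ (assoc _ _ _) ⟩
    s i ∙ ((s i ∙ t) ∙ (s i ∙ eval xs))        ≈⟨ ∙-congˡ (assoc _ _ _) ⟩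
    s i ∙ (s i ∙ (t ∙ (s i ∙ eval xs)))        ≈⟨ s∙s∙x≈x i _ ⟩
    t ∙ (s i ∙ eval xs)                        ∎)

  leftDescent : Carrier → Fin n → Bool
  leftDescent w i = inverts w (s i)

  conj-s-self : ∀ i → conj i (s i) ≈ s i
  conj-s-self i = trans (∙-congʳ (involution i)) (identityˡ _)

  leftDescent-s∙ : ∀ i w → leftDescent (s i ∙ w) i ≡ not (leftDescent w i)
  leftDescent-s∙ i w = P.trans (inverts-s∙ i w (s i)) (P.cong₂ _xor_ (≈⇒≈ᵇ refl) (inverts-resp w (conj-s-self i)))

  leftDescent⇒ℓ : ∀ i w → leftDescent w i ≡ true → suc (ℓ (s i ∙ w)) ≡ ℓ w
  leftDescent⇒ℓ i w desc with parity⇒shorter (reducedWord w) (s i) desc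
  ... | ys , len , ys≈ = ≤-antisym
    (≤-trans (s≤s (ℓ-minimal (s i ∙ w) ys (trans ys≈ (∙-congˡ (eval-reducedWord w)))))
             (≤-reflexive (P.trans len (length-reducedWord w))))
    (≤-trans (≤-reflexive (ℓ-cong (sym (s∙s∙x≈x i w)))) (ℓ-s∙ i (s i ∙ w)))

  ¬leftDescent⇒ℓ : ∀ i w → leftDescent w i ≡ false → ℓ (s i ∙ w) ≡ suc (ℓ w)
  ¬leftDescent⇒ℓ i w ¬desc = P.trans (P.sym (leftDescent⇒ℓ i (s i ∙ w) desc)) (P.cong suc (ℓ-cong (s∙s∙x≈x i w)))
    where
    desc : leftDescent (s i ∙ w) i ≡ true
    desc = P.trans (leftDescent-s∙ i w) (P.cong not ¬desc)

  ℓ⇒leftDescent : ∀ i w → ℓ (s i ∙ w) < ℓ w → leftDescent w i ≡ true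
  ℓ⇒leftDescent i w shorter with leftDescent w i in eq
  ... | true = P.refl
  ... | false = ⊥-elim (<⇒≱ shorter (≤-trans (n≤1+n _) (≤-reflexive (P.sym (¬leftDescent⇒ℓ i w eq)))))

  Commute : Fin n → Fin n → Set
  Commute i j = s i ∙ s j ≈ s j ∙ s i

  conj-commuting : ∀ {i j} → Commute i j → conj i (s j) ≈ s j
  conj-commuting {i} {j} comm = trans (∙-congʳ comm) (x∙s∙s≈x i (s j))

  leftDescent-s∙-commuting : ∀ {i j} w → Commute i j → i ≢ j → leftDescent (s i ∙ w) j ≡ leftDescent w j
  leftDescent-s∙-commuting {i} {j} w comm i≢j = P.trans (inverts-s∙ i w (s j))
    (P.cong₂ _xor_ (≉⇒≈ᵇ λ sj≈si → i≢j (s-injective i j (sym sj≈si))) (inverts-resp w (conj-commuting comm)))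

  rightDescent : Carrier → Fin n → Bool
  rightDescent w = leftDescent (w ⁻¹)

  ⁻¹-∙s : ∀ w i → (w ∙ s i) ⁻¹ ≈ s i ∙ w ⁻¹
  ⁻¹-∙s w i = trans (⁻¹-anti-homo-∙ w (s i)) (∙-congʳ (s⁻¹≈s i))

  ℓ-∙s≡ℓ-s∙⁻¹ : ∀ w i → ℓ (w ∙ s i) ≡ ℓ (s i ∙ w ⁻¹)
  ℓ-∙s≡ℓ-s∙⁻¹ w i = P.trans (P.sym (ℓ-⁻¹ (w ∙ s i))) (ℓ-cong (⁻¹-∙s w i))

  rightDescent⇒ℓ : ∀ i w → rightDescent w i ≡ true → suc (ℓ (w ∙ s i)) ≡ ℓ w
  rightDescent⇒ℓ i w desc = P.trans (P.cong suc (ℓ-∙s≡ℓ-s∙⁻¹ w i)) (P.trans (leftDescent⇒ℓ i (w ⁻¹) desc) (ℓ-⁻¹ w))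

  ¬rightDescent⇒ℓ : ∀ i w → rightDescent w i ≡ false → ℓ (w ∙ s i) ≡ suc (ℓ w)
  ¬rightDescent⇒ℓ i w ¬desc =
    P.trans (ℓ-∙s≡ℓ-s∙⁻¹ w i) (P.trans (¬leftDescent⇒ℓ i (w ⁻¹) ¬desc) (P.cong suc (ℓ-⁻¹ w)))

  rightDescent-cong : ∀ {w w′} → w ≈ w′ → ∀ i → rightDescent w i ≡ rightDescent w′ i
  rightDescent-cong w≈w′ i = inverts-cong (⁻¹-cong w≈w′) (s i)

  rightDescent-∙s : ∀ i w → rightDescent (w ∙ s i) i ≡ not (rightDescent w i)
  rightDescent-∙s i w = P.trans (inverts-cong (⁻¹-∙s w i) (s i)) (leftDescent-s∙ i (w ⁻¹))

  rightDescent-∙s-commuting : ∀ {i j} w → Commute i j → i ≢ j → rightDescent (w ∙ s i) j ≡ rightDescent w j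
  rightDescent-∙s-commuting w comm i≢j = P.trans (inverts-cong (⁻¹-∙s w _) (s _)) (leftDescent-s∙-commuting (w ⁻¹) comm i≢j)

  rightDescent-ε : ∀ i → rightDescent ε i ≡ false
  rightDescent-ε i = P.trans (inverts-cong ε⁻¹≈ε (s i)) (inverts-word [] refl (s i))

  parity-commuting : ∀ {xs} → AllPairs Commute xs → ∀ t → parity xs t ≡ true → ∃ λ k → k ∈ₚ xs × t ≈ s k
  parity-commuting {i ∷ xs} (i-comm ∷ xs-comm) t odd with t ≈? s i
  ... | yes t≈s = i , here P.refl , t≈s
  ... | no _ with parity-commuting xs-comm (conj i t) odd
  ... | k , k∈xs , conj≈s = k , there k∈xs ,
    trans (sym (conj-involutive i t)) (trans (conj-cong i conj≈s) (conj-commuting (All.lookup i-comm k∈xs)))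

  parity-twoLetters : ∀ {i a t} → ¬ t ≈ s i → parity (i ∷ a ∷ []) t ≡ true → conj i t ≈ s a
  parity-twoLetters {i} {a} {t} t≉sᵢ odd with t ≈? s i | conj i t ≈? s a
  ... | yes t≈sᵢ | _ = ⊥-elim (t≉sᵢ t≈sᵢ)
  ... | no _ | yes conj≈sₐ = conj≈sₐ
  parity-twoLetters _ () | no _ | no _

  -- y = s i s a for some a, and the second descent s j forces conj i (s j) = s a.
  ℓ≡2⇒≈s∙s : ∀ {y i j} → ℓ y ≡ 2 → leftDescent y i ≡ true → leftDescent y j ≡ true → i ≢ j → y ≈ s j ∙ s i
  ℓ≡2⇒≈s∙s {y} {i} {j} ℓy≡2 desc-i desc-j i≢j = begin
    y                        ≈⟨ y≈ ⟩
    s i ∙ (s a ∙ ε)          ≈⟨ ∙-congˡ (trans (identityʳ _) (sym conj≈s)) ⟩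
    s i ∙ ((s i ∙ s j) ∙ s i) ≈⟨ assoc _ _ _ ⟨
    (s i ∙ (s i ∙ s j)) ∙ s i ≈⟨ ∙-congʳ (s∙s∙x≈x i (s j)) ⟩
    s j ∙ s i                ∎
    where
    a = proj₁ (ℓ≡1⇒≈s (suc-injective (P.trans (leftDescent⇒ℓ i y desc-i) ℓy≡2)))
    y≈ : y ≈ s i ∙ (s a ∙ ε)
    y≈ = trans (sym (s∙s∙x≈x i y))
      (∙-congˡ (trans (proj₂ (ℓ≡1⇒≈s (suc-injective (P.trans (leftDescent⇒ℓ i y desc-i) ℓy≡2)))) (sym (identityʳ _))))
    odd : parity (i ∷ a ∷ []) (s j) ≡ true
    odd = P.trans (P.sym (inverts-word (i ∷ a ∷ []) (sym y≈) (s j))) desc-j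
    conj≈s : conj i (s j) ≈ s a
    conj≈s = parity-twoLetters (λ sj≈si → i≢j (s-injective i j (sym sj≈si))) odd

  ℓ≡2⇒Commute : ∀ {y i j} → ℓ y ≡ 2 → leftDescent y i ≡ true → leftDescent y j ≡ true → i ≢ j → Commute i j
  ℓ≡2⇒Commute ℓy≡2 desc-i desc-j i≢j =
    trans (sym (ℓ≡2⇒≈s∙s ℓy≡2 desc-j desc-i (λ j≡i → i≢j (P.sym j≡i)))) (ℓ≡2⇒≈s∙s ℓy≡2 desc-i desc-j i≢j)

  private
    pow1 : ∀ x → pow x 1 ≈ x
    pow1 x = identityʳ x

    pow2 : ∀ x → pow x 2 ≈ x ∙ x
    pow2 x = ∙-congˡ (identityʳ x)

    orderAtLeast3 : ∀ {x} → ¬ pow x 1 ≈ ε → ¬ pow x 2 ≈ ε → OrderAtLeast3 x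
    orderAtLeast3 x¹≉ε x²≉ε (suc zero) _ _ = x¹≉ε
    orderAtLeast3 x¹≉ε x²≉ε (suc (suc zero)) _ _ = x²≉ε
    orderAtLeast3 _ _ (suc (suc (suc _))) _ (s≤s (s≤s (s≤s ())))

  edge? : ∀ i j → Dec (Edge i j)
  edge? i j with pow (s i ∙ s j) 1 ≈? ε | pow (s i ∙ s j) 2 ≈? ε
  ... | yes x¹≈ε | _ = no λ edge → edge 1 (s≤s z≤n) (s≤s (s≤s z≤n)) x¹≈ε
  ... | no _ | yes x²≈ε = no λ edge → edge 2 (s≤s z≤n) (s≤s (s≤s (s≤s z≤n))) x²≈ε
  ... | no x¹≉ε | no x²≉ε = yes (orderAtLeast3 x¹≉ε x²≉ε)

  -- m(i,j) ≤ 2: either s i = s j, or s i s j is an involution.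
  ¬Edge⇒Commute : ∀ i j → ¬ Edge i j → Commute i j
  ¬Edge⇒Commute i j ¬edge with pow (s i ∙ s j) 1 ≈? ε | pow (s i ∙ s j) 2 ≈? ε
  ... | yes x¹≈ε | _ = trans (∙-congˡ sj≈si) (∙-congʳ (sym sj≈si))
    where
    sj≈si : s j ≈ s i
    sj≈si = trans (sym (s∙s∙x≈x i (s j))) (trans (∙-congˡ (trans (sym (pow1 _)) x¹≈ε)) (identityʳ _))
  ... | no _ | yes x²≈ε = begin
    s i ∙ s j            ≈⟨ inverseˡ-unique _ _ (trans (sym (pow2 _)) x²≈ε) ⟩
    (s i ∙ s j) ⁻¹       ≈⟨ ⁻¹-anti-homo-∙ (s i) (s j) ⟩
    s j ⁻¹ ∙ s i ⁻¹      ≈⟨ ∙-cong (s⁻¹≈s j) (s⁻¹≈s i) ⟩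
    s j ∙ s i            ∎
  ... | no x¹≉ε | no x²≉ε = ⊥-elim (¬edge (orderAtLeast3 x¹≉ε x²≉ε))

  Commute⇒¬Edge : ∀ i j → Commute i j → ¬ Edge i j
  Commute⇒¬Edge i j comm edge = edge 2 (s≤s z≤n) (s≤s (s≤s (s≤s z≤n))) (begin
    pow (s i ∙ s j) 2          ≈⟨ pow2 _ ⟩
    (s i ∙ s j) ∙ (s i ∙ s j)  ≈⟨ ∙-congˡ comm ⟩
    (s i ∙ s j) ∙ (s j ∙ s i)  ≈⟨ assoc _ _ _ ⟩
    s i ∙ (s j ∙ (s j ∙ s i))  ≈⟨ ∙-congˡ (s∙s∙x≈x j (s i)) ⟩
    s i ∙ s i                  ≈⟨ involution i ⟩
    ε                          ∎)

  -- The right weak order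

  ℓ≡⇒≤R : ∀ {u w} → ℓ w ≡ ℓ u + ℓ (u ⁻¹ ∙ w) → u ≤R w
  ℓ≡⇒≤R {u} {w} eq = ℓ w , ℓ u , ℓ (u ⁻¹ ∙ w) , HasLength-ℓ w , HasLength-ℓ u , HasLength-ℓ (u ⁻¹ ∙ w) , eq

  ≤R⇒ℓ≡ : ∀ {u w} → u ≤R w → ℓ w ≡ ℓ u + ℓ (u ⁻¹ ∙ w)
  ≤R⇒ℓ≡ (_ , _ , _ , hasℓw , hasℓu , hasℓu⁻¹w , eq) =
    P.trans (P.sym (HasLength⇒≡ℓ hasℓw)) (P.trans eq (P.cong₂ _+_ (HasLength⇒≡ℓ hasℓu) (HasLength⇒≡ℓ hasℓu⁻¹w)))

  ℓ≤ℓ+ℓ⁻¹∙ : ∀ u w → ℓ w ≤ ℓ u + ℓ (u ⁻¹ ∙ w)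
  ℓ≤ℓ+ℓ⁻¹∙ u w = ≤-trans (≤-reflexive (ℓ-cong (sym (\\-leftDividesˡ u w)))) (ℓ-∙ u (u ⁻¹ ∙ w))

  ≤R-resp : ∀ {u u′ w w′} → u ≈ u′ → w ≈ w′ → u ≤R w → u′ ≤R w′
  ≤R-resp u≈u′ w≈w′ u≤w = ℓ≡⇒≤R (P.trans (P.sym (ℓ-cong w≈w′)) (P.trans (≤R⇒ℓ≡ u≤w)
    (P.cong₂ _+_ (ℓ-cong u≈u′) (ℓ-cong (∙-cong (⁻¹-cong u≈u′) w≈w′)))))

  ≤R-refl : ∀ u → u ≤R u
  ≤R-refl u = ℓ≡⇒≤R (P.sym (P.trans (P.cong (ℓ u +_) (P.trans (ℓ-cong (inverseˡ u)) ℓ-ε)) (+-identityʳ _)))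

  ≤R-trans : ∀ {u v w} → u ≤R v → v ≤R w → u ≤R w
  ≤R-trans {u} {v} {w} u≤v v≤w = ℓ≡⇒≤R (≤-antisym (ℓ≤ℓ+ℓ⁻¹∙ u w) (begin-≤
    ℓ u + ℓ (u ⁻¹ ∙ w)
      ≤⟨ +-monoʳ-≤ (ℓ u) (≤-trans (≤-reflexive (ℓ-cong (sym u⁻¹v∙v⁻¹w≈u⁻¹w))) (ℓ-∙ _ _)) ⟩
    ℓ u + (ℓ (u ⁻¹ ∙ v) + ℓ (v ⁻¹ ∙ w))       ≡⟨ +-assoc (ℓ u) _ _ ⟨
    (ℓ u + ℓ (u ⁻¹ ∙ v)) + ℓ (v ⁻¹ ∙ w)       ≡⟨ P.cong (_+ ℓ (v ⁻¹ ∙ w)) (≤R⇒ℓ≡ u≤v) ⟨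
    ℓ v + ℓ (v ⁻¹ ∙ w)                        ≡⟨ ≤R⇒ℓ≡ v≤w ⟨
    ℓ w                                       ∎-≤))
    where
    open ≤-Reasoning renaming (begin_ to begin-≤_; _∎ to _∎-≤)
    u⁻¹v∙v⁻¹w≈u⁻¹w : (u ⁻¹ ∙ v) ∙ (v ⁻¹ ∙ w) ≈ u ⁻¹ ∙ w
    u⁻¹v∙v⁻¹w≈u⁻¹w = trans (assoc _ _ _) (∙-congˡ (\\-leftDividesˡ v w))

  -- If u < w with ℓ w - ℓ u ≥ 2, then u s, with s the first letter of a reduced word of u⁻¹ w,
  -- lies strictly between them.
  ≤R-interpolate : ∀ {u w m} → u ≤R w → ℓ (u ⁻¹ ∙ w) ≡ suc (suc m) →
    ∃ λ z → u ≤R z × z ≤R w × ℓ z ≡ suc (ℓ u)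
  ≤R-interpolate {u} {w} {m} u≤w ℓx≡2+m
    with reducedWord (u ⁻¹ ∙ w) | length-reducedWord (u ⁻¹ ∙ w) | eval-reducedWord (u ⁻¹ ∙ w)
  ... | [] | len | _ with P.trans len ℓx≡2+m
  ...   | ()
  ≤R-interpolate {u} {w} {m} u≤w ℓx≡2+m | y ∷ ys | len | y∙ys≈x = u ∙ s y , u≤z , z≤w , ℓz≡1+ℓu
    where
    z = u ∙ s y
    ℓw≡ : ℓ w ≡ ℓ u + suc (suc m)
    ℓw≡ = P.trans (≤R⇒ℓ≡ u≤w) (P.cong (ℓ u +_) ℓx≡2+m)
    z⁻¹w≈ys : z ⁻¹ ∙ w ≈ eval ys
    z⁻¹w≈ys = begin
      (u ∙ s y) ⁻¹ ∙ w     ≈⟨ ∙-congʳ (⁻¹-∙s u y) ⟩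
      (s y ∙ u ⁻¹) ∙ w     ≈⟨ assoc _ _ _ ⟩
      s y ∙ (u ⁻¹ ∙ w)     ≈⟨ ∙-congˡ y∙ys≈x ⟨
      s y ∙ (s y ∙ eval ys) ≈⟨ s∙s∙x≈x y _ ⟩
      eval ys              ∎
    ℓz⁻¹w≤ : ℓ (z ⁻¹ ∙ w) ≤ suc m
    ℓz⁻¹w≤ = ≤-trans (ℓ-minimal _ ys (sym z⁻¹w≈ys)) (≤-reflexive (suc-injective (P.trans len ℓx≡2+m)))
    ℓw≤ : ℓ u + suc (suc m) ≤ ℓ z + ℓ (z ⁻¹ ∙ w)
    ℓw≤ = ≤-trans (≤-reflexive (P.sym ℓw≡)) (ℓ≤ℓ+ℓ⁻¹∙ z w)
    ℓz≡1+ℓu : ℓ z ≡ suc (ℓ u)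
    ℓz≡1+ℓu = ≤-antisym (ℓ-∙s y u) (+-cancelʳ-≤ (suc m) (suc (ℓ u)) (ℓ z)
      (≤-trans (≤-reflexive (P.sym (+-suc (ℓ u) (suc m)))) (≤-trans ℓw≤ (+-monoʳ-≤ (ℓ z) ℓz⁻¹w≤))))
    ℓz⁻¹w≡1+m : ℓ (z ⁻¹ ∙ w) ≡ suc m
    ℓz⁻¹w≡1+m = ≤-antisym ℓz⁻¹w≤ (+-cancelˡ-≤ (suc (ℓ u)) (suc m) _
      (≤-trans (≤-reflexive (P.sym (+-suc (ℓ u) (suc m))))
        (≤-trans ℓw≤ (≤-reflexive (P.cong (_+ ℓ (z ⁻¹ ∙ w)) ℓz≡1+ℓu)))))
    u≤z : u ≤R z
    u≤z = ℓ≡⇒≤R (P.trans ℓz≡1+ℓu (P.trans (+-comm 1 (ℓ u))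
      (P.cong (ℓ u +_) (P.sym (P.trans (ℓ-cong (\\-leftDividesʳ u (s y))) (ℓ-s y))))))
    z≤w : z ≤R w
    z≤w = ℓ≡⇒≤R (P.trans ℓw≡ (P.trans (+-suc (ℓ u) (suc m)) (P.sym (P.cong₂ _+_ ℓz≡1+ℓu ℓz⁻¹w≡1+m))))

  record IsCommutingFamily {k} (j : Fin k → Fin n) : Set where
    field
      injective : ∀ {p q} → j p ≡ j q → p ≡ q
      commute : ∀ p q → Commute (j p) (j q)

    ≢⇒≢ : ∀ {p q} → p ≢ q → j p ≢ j q
    ≢⇒≢ p≢q jp≡jq = p≢q (injective jp≡jq)

  IsCommutingFamily-tail : ∀ {k} {j : Fin (suc k) → Fin n} → IsCommutingFamily j → IsCommutingFamily (λ p → j (suc p))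
  IsCommutingFamily-tail family = record
    { injective = λ eq → Fin.suc-injective (IsCommutingFamily.injective family eq)
    ; commute = λ p q → IsCommutingFamily.commute family (suc p) (suc q) }

  prod : ∀ {k} → (Fin k → Fin n) → Subset k → Carrier
  prod j A = eval (select A j)

  s∙eval-commuting : ∀ i {xs} → All (Commute i) xs → s i ∙ eval xs ≈ eval xs ∙ s i
  s∙eval-commuting i [] = trans (identityʳ _) (sym (identityˡ _))
  s∙eval-commuting i {x ∷ xs} (comm ∷ comms) = begin
    s i ∙ (s x ∙ eval xs)   ≈⟨ assoc _ _ _ ⟨
    (s i ∙ s x) ∙ eval xs   ≈⟨ ∙-congʳ comm ⟩
    (s x ∙ s i) ∙ eval xs   ≈⟨ assoc _ _ _ ⟩
    s x ∙ (s i ∙ eval xs)   ≈⟨ ∙-congˡ (s∙eval-commuting i comms) ⟩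
    s x ∙ (eval xs ∙ s i)   ≈⟨ assoc _ _ _ ⟨
    (s x ∙ eval xs) ∙ s i   ∎

  prod-⊕ : ∀ {k} {j : Fin k → Fin n} → (∀ p q → Commute (j p) (j q)) → ∀ A B → prod j A ∙ prod j B ≈ prod j (A ⊕ B)
  prod-⊕ {j = j} comm [] [] = identityʳ _
  prod-⊕ {j = j} comm (true ∷ A) (true ∷ B) = begin
    (s (j zero) ∙ prod j′ A) ∙ (s (j zero) ∙ prod j′ B)  ≈⟨ ∙-congʳ (s∙prod′ A) ⟩
    (prod j′ A ∙ s (j zero)) ∙ (s (j zero) ∙ prod j′ B)  ≈⟨ assoc _ _ _ ⟩
    prod j′ A ∙ (s (j zero) ∙ (s (j zero) ∙ prod j′ B))  ≈⟨ ∙-congˡ (s∙s∙x≈x (j zero) _) ⟩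
    prod j′ A ∙ prod j′ B                                ≈⟨ prod-⊕ (λ p q → comm (suc p) (suc q)) A B ⟩
    prod j′ (A ⊕ B)                                      ∎
    where
    j′ = λ p → j (suc p)
    s∙prod′ : ∀ A → s (j zero) ∙ prod j′ A ≈ prod j′ A ∙ s (j zero)
    s∙prod′ A = s∙eval-commuting (j zero) (All-select A j′ (comm zero ∘ suc))
  prod-⊕ {j = j} comm (true ∷ A) (false ∷ B) = trans (assoc _ _ _) (∙-congˡ (prod-⊕ (λ p q → comm (suc p) (suc q)) A B))
  prod-⊕ {j = j} comm (false ∷ A) (true ∷ B) = begin
    prod j′ A ∙ (s (j zero) ∙ prod j′ B)   ≈⟨ assoc _ _ _ ⟨
    (prod j′ A ∙ s (j zero)) ∙ prod j′ B   ≈⟨ ∙-congʳ (s∙eval-commuting (j zero) (All-select A j′ (comm zero ∘ suc))) ⟨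
    (s (j zero) ∙ prod j′ A) ∙ prod j′ B   ≈⟨ assoc _ _ _ ⟩
    s (j zero) ∙ (prod j′ A ∙ prod j′ B)   ≈⟨ ∙-congˡ (prod-⊕ (λ p q → comm (suc p) (suc q)) A B) ⟩
    s (j zero) ∙ prod j′ (A ⊕ B)           ∎
    where j′ = λ p → j (suc p)
  prod-⊕ {j = j} comm (false ∷ A) (false ∷ B) = prod-⊕ (λ p q → comm (suc p) (suc q)) A B

  module _ {k} {j : Fin k → Fin n} where

    prod-⊥ : prod j ⊥ ≈ ε
    prod-⊥ = reflexive (P.cong eval (select-⊥ j))

    prod-⁅⁆ : ∀ p → prod j ⁅ p ⁆ ≈ s (j p)
    prod-⁅⁆ p = trans (reflexive (P.cong eval (select-⁅⁆ j p))) (identityʳ _)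

    module _ (family : IsCommutingFamily j) where
      open IsCommutingFamily family

      prod-⁻¹ : ∀ A → prod j A ⁻¹ ≈ prod j A
      prod-⁻¹ A = sym (inverseˡ-unique _ _ (trans (prod-⊕ commute A A) (trans (reflexive (P.cong (prod j) (⊕-self A))) prod-⊥)))

      s∙prod : ∀ p A → s (j p) ∙ prod j A ≈ prod j (⁅ p ⁆ ⊕ A)
      s∙prod p A = trans (∙-congʳ (sym (prod-⁅⁆ p))) (prod-⊕ commute ⁅ p ⁆ A)

      leftDescent-prod⁻ : ∀ A {i} → leftDescent (prod j A) i ≡ true → ∃ λ p → p ∈ A × j p ≡ i
      leftDescent-prod⁻ A {i} desc
        with parity-commuting (AllPairs-select A j (λ {p} {q} _ → commute p q)) (s i)
               (P.trans (P.sym (inverts-word (select A j) refl (s i))) desc)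
      ... | i′ , i′∈ , si≈si′ with s-injective i i′ si≈si′
      ... | P.refl = ∈-select⁻ A j i′∈

  NoRightDescentIn : ∀ {k} → Carrier → (Fin k → Fin n) → Set
  NoRightDescentIn u j = ∀ p → rightDescent u (j p) ≡ false

  ℓ-∙prod : ∀ {k} {j : Fin k → Fin n} → IsCommutingFamily j → ∀ {u} → NoRightDescentIn u j →
    ∀ A → ℓ (u ∙ prod j A) ≡ ℓ u + ∣ A ∣
  ℓ-∙prod {j = j} family {u} noDesc [] = P.trans (ℓ-cong (identityʳ u)) (P.sym (+-identityʳ _))
  ℓ-∙prod {j = j} family {u} noDesc (true ∷ A) = begin-≡
    ℓ (u ∙ (s (j zero) ∙ prod j′ A))   ≡⟨ ℓ-cong (assoc u _ _) ⟨
    ℓ ((u ∙ s (j zero)) ∙ prod j′ A)   ≡⟨ ℓ-∙prod (IsCommutingFamily-tail family) noDesc′ A ⟩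
    ℓ (u ∙ s (j zero)) + ∣ A ∣         ≡⟨ P.cong (_+ ∣ A ∣) (¬rightDescent⇒ℓ (j zero) u (noDesc zero)) ⟩
    suc (ℓ u) + ∣ A ∣                  ≡⟨ +-suc (ℓ u) ∣ A ∣ ⟨
    ℓ u + suc ∣ A ∣                    ∎-≡
    where
    open P.≡-Reasoning renaming (begin_ to begin-≡_; _∎ to _∎-≡)
    open IsCommutingFamily family
    j′ = λ p → j (suc p)
    noDesc′ : NoRightDescentIn (u ∙ s (j zero)) j′
    noDesc′ p = P.trans (rightDescent-∙s-commuting u (commute zero (suc p)) (≢⇒≢ λ ())) (noDesc (suc p))
  ℓ-∙prod {j = j} family noDesc (false ∷ A) = ℓ-∙prod (IsCommutingFamily-tail family) (λ p → noDesc (suc p)) A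

  module _ {k} {j : Fin k → Fin n} (family : IsCommutingFamily j) where

    ℓ-prod : ∀ A → ℓ (prod j A) ≡ ∣ A ∣
    ℓ-prod A = P.trans (ℓ-cong (sym (identityˡ _)))
      (P.trans (ℓ-∙prod family (λ p → rightDescent-ε (j p)) A) (P.cong (_+ ∣ A ∣) ℓ-ε))

    leftDescent-prod⁺ : ∀ {A p} → p ∈ A → leftDescent (prod j A) (j p) ≡ true
    leftDescent-prod⁺ {A} {p} p∈A = ℓ⇒leftDescent (j p) (prod j A) (≤-reflexive (begin-≡
      suc (ℓ (s (j p) ∙ prod j A))   ≡⟨ P.cong suc (ℓ-cong (s∙prod family p A)) ⟩
      suc (ℓ (prod j (⁅ p ⁆ ⊕ A)))   ≡⟨ P.cong suc (ℓ-prod (⁅ p ⁆ ⊕ A)) ⟩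
      suc ∣ ⁅ p ⁆ ⊕ A ∣              ≡⟨ ∣⁅⁆⊕∣ p∈A ⟨
      ∣ A ∣                          ≡⟨ ℓ-prod A ⟨
      ℓ (prod j A)                   ∎-≡))
      where open P.≡-Reasoning renaming (begin_ to begin-≡_; _∎ to _∎-≡)

    prod-prefix : ∀ ys zs A → eval (ys ++ zs) ≈ prod j A → length (ys ++ zs) ≡ ∣ A ∣ →
      ∃ λ A′ → eval ys ≈ prod j A′
    prod-prefix [] zs A _ _ = ⊥ , sym (prod-⊥ {j = j})
    prod-prefix (y ∷ ys) zs A y∙ys∙zs≈ len = ⁅ p ⁆ ⊕ A′ , (begin
      s y ∙ eval ys             ≈⟨ ∙-cong sy≈sjp ys≈ ⟩
      s (j p) ∙ prod j A′       ≈⟨ s∙prod family p A′ ⟩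
      prod j (⁅ p ⁆ ⊕ A′)       ∎)
      where
      shorter : ℓ (s y ∙ prod j A) < ℓ (prod j A)
      shorter = ≤-trans (s≤s (ℓ-minimal (s y ∙ prod j A) (ys ++ zs) (trans (sym (s∙s∙x≈x y _)) (∙-congˡ y∙ys∙zs≈))))
                        (≤-reflexive (P.trans len (P.sym (ℓ-prod A))))
      descent = leftDescent-prod⁻ family A (ℓ⇒leftDescent y (prod j A) shorter)
      p = proj₁ descent
      p∈A : p ∈ A
      p∈A = proj₁ (proj₂ descent)
      sy≈sjp : s y ≈ s (j p)
      sy≈sjp = reflexive (P.cong s (P.sym (proj₂ (proj₂ descent))))
      ys∙zs≈ : eval (ys ++ zs) ≈ prod j (⁅ p ⁆ ⊕ A)
      ys∙zs≈ = trans (sym (s∙s∙x≈x y _)) (trans (∙-congˡ y∙ys∙zs≈) (trans (∙-congʳ sy≈sjp) (s∙prod family p A)))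
      prefix = prod-prefix ys zs (⁅ p ⁆ ⊕ A) ys∙zs≈ (suc-injective (P.trans len (∣⁅⁆⊕∣ p∈A)))
      A′ = proj₁ prefix
      ys≈ : eval ys ≈ prod j A′
      ys≈ = proj₂ prefix

  -- Standard Boolean intervals [u , u ∙ prod j ⊤]

  module _ {k} {j : Fin k → Fin n} (family : IsCommutingFamily j) {u} (noDesc : NoRightDescentIn u j) where

    private
      f : Subset k → Carrier
      f A = u ∙ prod j A

      ℓ-f : ∀ A → ℓ (f A) ≡ ℓ u + ∣ A ∣
      ℓ-f = ℓ-∙prod family noDesc

      f⁻¹∙f : ∀ A B → f A ⁻¹ ∙ f B ≈ prod j (A ⊕ B)
      f⁻¹∙f A B = begin
        (u ∙ prod j A) ⁻¹ ∙ (u ∙ prod j B)       ≈⟨ ∙-congʳ (⁻¹-anti-homo-∙ u _) ⟩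
        (prod j A ⁻¹ ∙ u ⁻¹) ∙ (u ∙ prod j B)    ≈⟨ assoc _ _ _ ⟩
        prod j A ⁻¹ ∙ (u ⁻¹ ∙ (u ∙ prod j B))    ≈⟨ ∙-cong (prod-⁻¹ family A) (\\-leftDividesʳ u _) ⟩
        prod j A ∙ prod j B                      ≈⟨ prod-⊕ (IsCommutingFamily.commute family) A B ⟩
        prod j (A ⊕ B)                           ∎

      ℓ-f⁻¹∙f : ∀ A B → ℓ (f A ⁻¹ ∙ f B) ≡ ∣ A ⊕ B ∣
      ℓ-f⁻¹∙f A B = P.trans (ℓ-cong (f⁻¹∙f A B)) (ℓ-prod family (A ⊕ B))

      f-≤R⇒⊆ : ∀ A B → f A ≤R f B → A ⊆ B
      f-≤R⇒⊆ A B fA≤fB = ∣∣≡∣∣+∣⊕∣⇒⊆ B A (+-cancelˡ-≡ (ℓ u) _ _ (begin-≡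
        ℓ u + ∣ B ∣                                ≡⟨ ℓ-f B ⟨
        ℓ (f B)                                    ≡⟨ ≤R⇒ℓ≡ fA≤fB ⟩
        ℓ (f A) + ℓ (f A ⁻¹ ∙ f B)                 ≡⟨ P.cong₂ _+_ (ℓ-f A) (ℓ-f⁻¹∙f A B) ⟩
        (ℓ u + ∣ A ∣) + ∣ A ⊕ B ∣                  ≡⟨ +-assoc (ℓ u) _ _ ⟩
        ℓ u + (∣ A ∣ + ∣ A ⊕ B ∣)                  ∎-≡))
        where open P.≡-Reasoning renaming (begin_ to begin-≡_; _∎ to _∎-≡)

      ⊆⇒f-≤R : ∀ A B → A ⊆ B → f A ≤R f B
      ⊆⇒f-≤R A B A⊆B = ℓ≡⇒≤R (begin-≡
        ℓ (f B)                                    ≡⟨ ℓ-f B ⟩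
        ℓ u + ∣ B ∣                                ≡⟨ P.cong (ℓ u +_) (⊆⇒∣∣≡∣∣+∣⊕∣ A⊆B) ⟩
        ℓ u + (∣ A ∣ + ∣ A ⊕ B ∣)                  ≡⟨ +-assoc (ℓ u) _ _ ⟨
        (ℓ u + ∣ A ∣) + ∣ A ⊕ B ∣                  ≡⟨ P.cong₂ _+_ (ℓ-f A) (ℓ-f⁻¹∙f A B) ⟨
        ℓ (f A) + ℓ (f A ⁻¹ ∙ f B)                 ∎-≡)
        where open P.≡-Reasoning renaming (begin_ to begin-≡_; _∎ to _∎-≡)

      f⊥≈u : f ⊥ ≈ u
      f⊥≈u = trans (∙-congˡ (prod-⊥ {j = j})) (identityʳ u)

      -- A reduced word of u⁻¹ v followed by one of v⁻¹ (u ∙ prod j ⊤) is a reduced word of prod j ⊤.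
      f-surjective : ∀ v → u ≤R v → v ≤R f ⊤ → ∃ λ A → v ≈ f A
      f-surjective v u≤v v≤f⊤ = proj₁ prefix , (begin
        v                               ≈⟨ \\-leftDividesˡ u v ⟨
        u ∙ (u ⁻¹ ∙ v)                  ≈⟨ ∙-congˡ (eval-reducedWord x) ⟨
        u ∙ eval (reducedWord x)        ≈⟨ ∙-congˡ (proj₂ prefix) ⟩
        u ∙ prod j (proj₁ prefix)       ∎)
        where
        x = u ⁻¹ ∙ v
        y = v ⁻¹ ∙ f ⊤
        xy≈ : eval (reducedWord x ++ reducedWord y) ≈ prod j ⊤
        xy≈ = begin
          eval (reducedWord x ++ reducedWord y)       ≈⟨ eval-++ (reducedWord x) (reducedWord y) ⟩
          eval (reducedWord x) ∙ eval (reducedWord y) ≈⟨ ∙-cong (eval-reducedWord x) (eval-reducedWord y) ⟩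
          (u ⁻¹ ∙ v) ∙ (v ⁻¹ ∙ (u ∙ prod j ⊤))        ≈⟨ assoc _ _ _ ⟩
          u ⁻¹ ∙ (v ∙ (v ⁻¹ ∙ (u ∙ prod j ⊤)))        ≈⟨ ∙-congˡ (\\-leftDividesˡ v _) ⟩
          u ⁻¹ ∙ (u ∙ prod j ⊤)                       ≈⟨ \\-leftDividesʳ u _ ⟩
          prod j ⊤                                    ∎
        len : length (reducedWord x ++ reducedWord y) ≡ ∣ ⊤ {k} ∣
        len = +-cancelˡ-≡ (ℓ u) _ _ (begin-≡
          ℓ u + length (reducedWord x ++ reducedWord y)   ≡⟨ P.cong (ℓ u +_) (length-++ (reducedWord x)) ⟩
          ℓ u + (length (reducedWord x) + length (reducedWord y))
            ≡⟨ P.cong (ℓ u +_) (P.cong₂ _+_ (length-reducedWord x) (length-reducedWord y)) ⟩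
          ℓ u + (ℓ x + ℓ y)                               ≡⟨ +-assoc (ℓ u) _ _ ⟨
          (ℓ u + ℓ x) + ℓ y                               ≡⟨ P.cong (_+ ℓ y) (≤R⇒ℓ≡ u≤v) ⟨
          ℓ v + ℓ y                                       ≡⟨ ≤R⇒ℓ≡ v≤f⊤ ⟨
          ℓ (f ⊤)                                         ≡⟨ ℓ-f ⊤ ⟩
          ℓ u + ∣ ⊤ {k} ∣                                 ∎-≡)
          where open P.≡-Reasoning renaming (begin_ to begin-≡_; _∎ to _∎-≡)
        prefix = prod-prefix family (reducedWord x) (reducedWord y) ⊤ xy≈ len

    isBooleanInterval-standard : IsBooleanInterval k u (u ∙ prod j ⊤)
    isBooleanInterval-standard = f ,
      (λ A → ≤R-resp f⊥≈u refl (⊆⇒f-≤R ⊥ A (⊆-min A)) , ⊆⇒f-≤R A ⊤ ⊆⊤) ,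
      (λ A B → f-≤R⇒⊆ A B , ⊆⇒f-≤R A B) ,
      f-surjective

  leftDescents⇒≈prod : ∀ {k} {j : Fin k → Fin n} → IsCommutingFamily j → ∀ {x} →
    (∀ p → leftDescent x (j p) ≡ true) → ℓ x ≡ k → x ≈ prod j ⊤
  leftDescents⇒≈prod {zero} family desc ℓx≡0 = ℓ≡0⇒≈ε ℓx≡0
  leftDescents⇒≈prod {suc k} {j} family {x} desc ℓx≡1+k = trans (sym (s∙s∙x≈x (j zero) x))
    (∙-congˡ (leftDescents⇒≈prod (IsCommutingFamily-tail family) desc′
      (suc-injective (P.trans (leftDescent⇒ℓ _ x (desc zero)) ℓx≡1+k))))
    where
    open IsCommutingFamily family
    desc′ : ∀ p → leftDescent (s (j zero) ∙ x) (j (suc p)) ≡ true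
    desc′ p = P.trans (leftDescent-s∙-commuting x (commute zero (suc p)) (≢⇒≢ λ ())) (desc (suc p))

  -- For an independent set J, w₀ J is the longest element of the parabolic subgroup W_J.
  w₀ : Subset n → Carrier
  w₀ J = prod (elements J) ⊤

  module _ {k} {J : Subset n} (independent : IsIndependentSet k J) where

    isCommutingFamily-elements : IsCommutingFamily (elements J)
    isCommutingFamily-elements = record
      { injective = elements-injective J
      ; commute = λ p q → ¬Edge⇒Commute _ _ (proj₂ independent _ _ (elements-∈ J p) (elements-∈ J q)) }

    isBooleanInterval-w₀ : ∀ {u} → NoRightDescentIn u (elements J) → IsBooleanInterval k u (u ∙ w₀ J)
    isBooleanInterval-w₀ {u} noDesc = P.subst (λ m → IsBooleanInterval m u (u ∙ w₀ J)) (proj₁ independent)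
      (isBooleanInterval-standard isCommutingFamily-elements noDesc)

  w₀-injective : ∀ {k J J′} → IsIndependentSet k J → IsIndependentSet k J′ → w₀ J ≈ w₀ J′ → J ≡ J′
  w₀-injective independent independent′ w₀J≈w₀J′ =
    ⊆-antisym (w₀-mono independent independent′ w₀J≈w₀J′) (w₀-mono independent′ independent (sym w₀J≈w₀J′))
    where
    w₀-mono : ∀ {k J J′} → IsIndependentSet k J → IsIndependentSet k J′ → w₀ J ≈ w₀ J′ → J ⊆ J′
    w₀-mono {J = J} {J′} independent independent′ w₀J≈w₀J′ {i} i∈J =
      P.subst (_∈ J′) (P.trans (proj₂ (proj₂ descent)) (proj₂ position)) (elements-∈ J′ (proj₁ descent))
      where
      position = elements-surjective J i∈J
      p = proj₁ position
      descent = leftDescent-prod⁻ (isCommutingFamily-elements independent′) ⊤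
        (P.trans (P.sym (inverts-cong w₀J≈w₀J′ (s (elements J p))))
          (leftDescent-prod⁺ (isCommutingFamily-elements independent) (∈⊤ {x = p})))

  -- Every Boolean interval is standard

  module BooleanInterval {k u w} (boolean : IsBooleanInterval k u w) where

    private
      f : Subset k → Carrier
      f = proj₁ boolean

      f-bounded : ∀ A → u ≤R f A × f A ≤R w
      f-bounded = proj₁ (proj₂ boolean)

      f-≤R⇒⊆ : ∀ {A B} → f A ≤R f B → A ⊆ B
      f-≤R⇒⊆ = proj₁ (proj₁ (proj₂ (proj₂ boolean)) _ _)

      ⊆⇒f-≤R : ∀ {A B} → A ⊆ B → f A ≤R f B
      ⊆⇒f-≤R = proj₂ (proj₁ (proj₂ (proj₂ boolean)) _ _)

      f-surjective : ∀ v → u ≤R v → v ≤R w → ∃ λ A → v ≈ f A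
      f-surjective = proj₂ (proj₂ (proj₂ boolean))

      f-injective : ∀ {A B} → f A ≈ f B → A ≡ B
      f-injective {A} fA≈fB =
        ⊆-antisym (f-≤R⇒⊆ (≤R-resp refl fA≈fB (≤R-refl (f A)))) (f-≤R⇒⊆ (≤R-resp fA≈fB refl (≤R-refl (f A))))

      u≤w : u ≤R w
      u≤w = ≤R-trans (proj₁ (f-bounded ⊥)) (proj₂ (f-bounded ⊥))

      f⊥≈u : f ⊥ ≈ u
      f⊥≈u = sym (trans u≈fA (reflexive (P.cong f A≡⊥)))
        where
        A = proj₁ (f-surjective u (≤R-refl u) u≤w)
        u≈fA = proj₂ (f-surjective u (≤R-refl u) u≤w)
        A≡⊥ : A ≡ ⊥
        A≡⊥ = ⊆-antisym (f-≤R⇒⊆ (≤R-resp u≈fA refl (proj₁ (f-bounded ⊥)))) (⊆-min A)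

      w≈f⊤ : w ≈ f ⊤
      w≈f⊤ = trans w≈fA (reflexive (P.cong f A≡⊤))
        where
        A = proj₁ (f-surjective w u≤w (≤R-refl w))
        w≈fA = proj₂ (f-surjective w u≤w (≤R-refl w))
        A≡⊤ : A ≡ ⊤
        A≡⊤ = ⊆-antisym ⊆⊤ (f-≤R⇒⊆ (≤R-resp refl w≈fA (proj₂ (f-bounded ⊤))))

      -- A gap ≥ 2 along a covering pair A′ ⋖ A would, by ≤R-interpolate, put some f C strictly between.
      ℓ-f-cover : ∀ {A′ A} → A′ ⊆ A → A′ ≢ A → (∀ {C} → A′ ⊆ C → C ⊆ A → C ≡ A′ ⊎ C ≡ A) →
        ℓ (f A) ≡ suc (ℓ (f A′))
      ℓ-f-cover {A′} {A} A′⊆A A′≢A covering = cover _ P.refl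
        where
        A′≤A : f A′ ≤R f A
        A′≤A = ⊆⇒f-≤R A′⊆A
        ℓfA≡ : ℓ (f A) ≡ ℓ (f A′) + ℓ (f A′ ⁻¹ ∙ f A)
        ℓfA≡ = ≤R⇒ℓ≡ A′≤A
        cover : ∀ d → ℓ (f A′ ⁻¹ ∙ f A) ≡ d → ℓ (f A) ≡ suc (ℓ (f A′))
        cover zero ℓd≡0 = ⊥-elim (A′≢A (f-injective (begin
          f A′                       ≈⟨ identityʳ _ ⟨
          f A′ ∙ ε                   ≈⟨ ∙-congˡ (ℓ≡0⇒≈ε ℓd≡0) ⟨
          f A′ ∙ (f A′ ⁻¹ ∙ f A)     ≈⟨ \\-leftDividesˡ _ (f A) ⟩
          f A                        ∎)))
        cover (suc zero) ℓd≡1 = P.trans ℓfA≡ (P.trans (P.cong (ℓ (f A′) +_) ℓd≡1) (+-comm _ 1))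
        cover (suc (suc m)) ℓd≡2+m = ⊥-elim (no-gap (≤R-interpolate A′≤A ℓd≡2+m))
          where
          no-gap : ¬ (∃ λ z → f A′ ≤R z × z ≤R f A × ℓ z ≡ suc (ℓ (f A′)))
          no-gap (z , A′≤z , z≤A , ℓz≡)
            with f-surjective z (≤R-trans (proj₁ (f-bounded A′)) A′≤z) (≤R-trans z≤A (proj₂ (f-bounded A)))
          ... | C , z≈fC with covering (f-≤R⇒⊆ (≤R-resp refl z≈fC A′≤z)) (f-≤R⇒⊆ (≤R-resp z≈fC refl z≤A))
          ... | inj₁ P.refl = 1+n≢n (P.trans (P.sym ℓz≡) (ℓ-cong z≈fC))
          ... | inj₂ P.refl = m+1+n≢m (ℓ (f A′)) (suc-injective (begin-≡
            suc (ℓ (f A′) + suc m)    ≡⟨ +-suc _ (suc m) ⟨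
            ℓ (f A′) + suc (suc m)    ≡⟨ P.trans ℓfA≡ (P.cong (ℓ (f A′) +_) ℓd≡2+m) ⟨
            ℓ (f A)                   ≡⟨ ℓ-cong z≈fC ⟨
            ℓ z                       ≡⟨ ℓz≡ ⟩
            suc (ℓ (f A′))            ∎-≡))
            where open P.≡-Reasoning renaming (begin_ to begin-≡_; _∎ to _∎-≡)

      ℓ-f : ∀ A → ℓ (f A) ≡ ℓ u + ∣ A ∣
      ℓ-f A = go ∣ A ∣ A P.refl
        where
        go : ∀ m A → ∣ A ∣ ≡ m → ℓ (f A) ≡ ℓ u + m
        go zero A ∣A∣≡0 with ∣∣≡0⇒≡⊥ A ∣A∣≡0
        ... | P.refl = P.trans (ℓ-cong f⊥≈u) (P.sym (+-identityʳ _))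
        go (suc m) A ∣A∣≡1+m with ∣∣≡suc⇒nonempty A ∣A∣≡1+m
        ... | x , x∈A = P.trans (ℓ-f-cover (⁅⁆⊕⊆ x∈A) (⁅⁆⊕≢ x∈A) (⁅⁆⊕-covered x∈A)) (P.trans
              (P.cong suc (go m (⁅ x ⁆ ⊕ A) (suc-injective (P.trans (P.sym (∣⁅⁆⊕∣ x∈A)) ∣A∣≡1+m))))
              (P.sym (+-suc _ _)))

      ℓ-u⁻¹∙f : ∀ A → ℓ (u ⁻¹ ∙ f A) ≡ ∣ A ∣
      ℓ-u⁻¹∙f A = +-cancelˡ-≡ (ℓ u) _ _ (P.trans (P.sym (≤R⇒ℓ≡ (proj₁ (f-bounded A)))) (ℓ-f A))

      atom : ∀ p → ∃ λ i → u ⁻¹ ∙ f ⁅ p ⁆ ≈ s i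
      atom p = ℓ≡1⇒≈s (P.trans (ℓ-u⁻¹∙f ⁅ p ⁆) (∣⁅x⁆∣≡1 p))

    -- the generator added by the atom f ⁅ p ⁆ = u ∙ s (j p)
    j : Fin k → Fin n
    j p = proj₁ (atom p)

    private
      f⁅⁆≈u∙s : ∀ p → f ⁅ p ⁆ ≈ u ∙ s (j p)
      f⁅⁆≈u∙s p = trans (sym (\\-leftDividesˡ u (f ⁅ p ⁆))) (∙-congˡ (proj₂ (atom p)))

      leftDescent-u⁻¹∙f : ∀ {A p} → p ∈ A → leftDescent (u ⁻¹ ∙ f A) (j p) ≡ true
      leftDescent-u⁻¹∙f {A} {p} p∈A = ℓ⇒leftDescent (j p) _ (≤-reflexive (+-cancelˡ-≡ (ℓ u) _ _ (begin-≡
        ℓ u + suc (ℓ (s (j p) ∙ (u ⁻¹ ∙ f A)))       ≡⟨ +-assoc (ℓ u) 1 _ ⟨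
        (ℓ u + 1) + ℓ (s (j p) ∙ (u ⁻¹ ∙ f A))
          ≡⟨ P.cong₂ _+_ (P.trans (ℓ-f ⁅ p ⁆) (P.cong (ℓ u +_) (∣⁅x⁆∣≡1 p))) (ℓ-cong f⁅⁆⁻¹∙f≈) ⟨
        ℓ (f ⁅ p ⁆) + ℓ (f ⁅ p ⁆ ⁻¹ ∙ f A)           ≡⟨ ≤R⇒ℓ≡ (⊆⇒f-≤R (⁅⁆⊆ p∈A)) ⟨
        ℓ (f A)                                      ≡⟨ ≤R⇒ℓ≡ (proj₁ (f-bounded A)) ⟩
        ℓ u + ℓ (u ⁻¹ ∙ f A)                         ∎-≡)))
        where
        open P.≡-Reasoning renaming (begin_ to begin-≡_; _∎ to _∎-≡)
        f⁅⁆⁻¹∙f≈ : f ⁅ p ⁆ ⁻¹ ∙ f A ≈ s (j p) ∙ (u ⁻¹ ∙ f A)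
        f⁅⁆⁻¹∙f≈ = trans (∙-congʳ (trans (⁻¹-cong (f⁅⁆≈u∙s p)) (⁻¹-∙s u (j p)))) (assoc _ _ _)

    noRightDescent : NoRightDescentIn u j
    noRightDescent p with rightDescent u (j p) in eq
    ... | false = P.refl
    ... | true = ⊥-elim (1+n≰n (≤-trans (n≤1+n (suc (ℓ u)))
      (≤-reflexive (P.trans (P.cong suc (P.sym ℓu∙s≡)) (rightDescent⇒ℓ (j p) u eq)))))
      where
      ℓu∙s≡ : ℓ (u ∙ s (j p)) ≡ suc (ℓ u)
      ℓu∙s≡ = P.trans (ℓ-cong (sym (f⁅⁆≈u∙s p)))
        (P.trans (ℓ-f ⁅ p ⁆) (P.trans (P.cong (ℓ u +_) (∣⁅x⁆∣≡1 p)) (+-comm (ℓ u) 1)))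

    isCommutingFamily : IsCommutingFamily j
    isCommutingFamily = record { injective = j-injective ; commute = j-commute }
      where
      j-injective : ∀ {p q} → j p ≡ j q → p ≡ q
      j-injective {p} {q} jp≡jq = x∈⁅y⁆⇒x≡y q (P.subst (p ∈_) ⁅p⁆≡⁅q⁆ (x∈⁅x⁆ p))
        where
        ⁅p⁆≡⁅q⁆ : ⁅ p ⁆ ≡ ⁅ q ⁆
        ⁅p⁆≡⁅q⁆ = f-injective
          (trans (f⁅⁆≈u∙s p) (trans (reflexive (P.cong (λ i → u ∙ s i) jp≡jq)) (sym (f⁅⁆≈u∙s q))))
      j-commute : ∀ p q → Commute (j p) (j q)
      j-commute p q with p Fin.≟ q
      ... | yes P.refl = refl
      ... | no p≢q = ℓ≡2⇒Commute (P.trans (ℓ-u⁻¹∙f (⁅ p ⁆ ⊕ ⁅ q ⁆)) (∣⁅⁆⊕⁅⁆∣ p≢q))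
        (leftDescent-u⁻¹∙f (⁅⁆⊆⁅⁆⊕⁅⁆ˡ p≢q (x∈⁅x⁆ p))) (leftDescent-u⁻¹∙f (⁅⁆⊆⁅⁆⊕⁅⁆ʳ p≢q (x∈⁅x⁆ q)))
        (λ jp≡jq → p≢q (j-injective jp≡jq))

    u⁻¹∙w≈prod : u ⁻¹ ∙ w ≈ prod j ⊤
    u⁻¹∙w≈prod = trans (∙-congˡ w≈f⊤) (leftDescents⇒≈prod isCommutingFamily
      (λ p → leftDescent-u⁻¹∙f (∈⊤ {x = p})) (P.trans (ℓ-u⁻¹∙f ⊤) (∣⊤∣≡n k)))

    J : Subset n
    J = Vec.tabulate (leftDescent (u ⁻¹ ∙ w))

    private
      ∈J⇔ : ∀ {i} → (i ∈ J → leftDescent (u ⁻¹ ∙ w) i ≡ true) × (leftDescent (u ⁻¹ ∙ w) i ≡ true → i ∈ J)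
      ∈J⇔ {i} = (λ i∈J → P.trans (P.sym (lookup∘tabulate _ i)) (∈⇒lookup i∈J))
              , (λ desc → lookup⇒∈ (P.trans (lookup∘tabulate _ i) desc))

      j∈J : ∀ p → j p ∈ J
      j∈J p = proj₂ ∈J⇔ (P.trans (inverts-cong u⁻¹∙w≈prod (s (j p))) (leftDescent-prod⁺ isCommutingFamily (∈⊤ {x = p})))

      ∈J⇒j : ∀ {i} → i ∈ J → ∃ λ p → j p ≡ i
      ∈J⇒j i∈J = proj₁ descent , proj₂ (proj₂ descent)
        where descent = leftDescent-prod⁻ isCommutingFamily ⊤ (P.trans (P.sym (inverts-cong u⁻¹∙w≈prod _)) (proj₁ ∈J⇔ i∈J))

      ∣J∣≡k : ∣ J ∣ ≡ k
      ∣J∣≡k = ∣∣≡-enumerated j (IsCommutingFamily.injective isCommutingFamily) j∈J ∈J⇒j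

    J-independent : IsIndependentSet k J
    J-independent = ∣J∣≡k , noEdge
      where
      noEdge : ∀ i i′ → i ∈ J → i′ ∈ J → ¬ Edge i i′
      noEdge i i′ i∈J i′∈J = P.subst₂ (λ a b → ¬ Edge a b) (proj₂ r) (proj₂ r′)
        (Commute⇒¬Edge _ _ (IsCommutingFamily.commute isCommutingFamily (proj₁ r) (proj₁ r′)))
        where
        r = ∈J⇒j i∈J
        r′ = ∈J⇒j i′∈J

    noRightDescent-J : NoRightDescentIn u (elements J)
    noRightDescent-J p = P.subst (λ i → rightDescent u i ≡ false) (proj₂ q) (noRightDescent (proj₁ q))
      where q = ∈J⇒j (elements-∈ J p)

    w≈u∙w₀J : w ≈ u ∙ w₀ J
    w≈u∙w₀J = trans (sym (\\-leftDividesˡ u w)) (∙-congˡ (leftDescents⇒≈prod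
      (isCommutingFamily-elements J-independent)
      (λ p → proj₁ ∈J⇔ (elements-∈ J p))
      (P.trans (ℓ-cong u⁻¹∙w≈prod) (P.trans (ℓ-prod isCommutingFamily ⊤) (P.trans (∣⊤∣≡n k) (P.sym ∣J∣≡k))))))

  boolean⇒standard : ∀ {k u w} → IsBooleanInterval k u w →
    ∃ λ J → IsIndependentSet k J × NoRightDescentIn u (elements J) × w ≈ u ∙ w₀ J
  boolean⇒standard boolean = J , J-independent , noRightDescent-J , w≈u∙w₀J
    where open BooleanInterval boolean

  -- Counting

  isIndependentSet? : ∀ k → U.Decidable (IsIndependentSet k)
  isIndependentSet? k A = (∣ A ∣ ≟ k) ×-dec
    Fin.all? (λ i → Fin.all? (λ i′ → (i ∈? A) →-dec (i′ ∈? A) →-dec ¬? (edge? i i′)))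

  independentSets : ℕ → List (Subset n)
  independentSets k = filter (isIndependentSet? k) (allSubsets n)

  independentSets-counts : ∀ k → CountsIndependentSets k (independentSets k)
  independentSets-counts k =
    AllPairs.filter⁺ (isIndependentSet? k) (allSubsets-unique n) ,
    all-filter (isIndependentSet? k) (allSubsets n) ,
    λ A independent → ∈-filter⁺ (isIndependentSet? k) (allSubsets-complete A) independent

  noRightDescentIn? : ∀ {k} (j : Fin k → Fin n) → U.Decidable (λ u → NoRightDescentIn u j)
  noRightDescentIn? j u = Fin.all? (λ p → rightDescent u (j p) Bool.≟ false)

  module _ {E : List Carrier} (enumeration : IsEnumeration E) where
    open DuplicateFree setoid

    private
      R : Fin n → U.Pred Carrier 0ℓ
      R i u = rightDescent u i ≡ false

      R? : ∀ i → U.Decidable (R i)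
      R? i u = rightDescent u i Bool.≟ false

      R-resp : ∀ i {x y} → x ≈ y → R i x → R i y
      R-resp i x≈y = P.trans (P.sym (rightDescent-cong x≈y i))

    -- u ↦ u ∙ s i exchanges the elements without right descent s i with those having one.
    length-filter-halves : ∀ i {Q : U.Pred Carrier 0ℓ} (Q? : U.Decidable Q) →
      (∀ {x y} → x ≈ y → Q x → Q y) → (∀ {u} → Q u → Q (u ∙ s i)) →
      length (filter Q? E) ≡ length (filter (R? i ∩? Q?) E) + length (filter (R? i ∩? Q?) E)
    length-filter-halves i Q? Q-resp Q-∙s =
      P.trans (length-filter-split (R? i) Q? E) (P.cong (length (filter (R? i ∩? Q?) E) +_) (P.sym
        (length-filter-swap (proj₁ enumeration) (proj₂ enumeration) ∙-congʳ (x∙s∙s≈x i) (R? i ∩? Q?) (∁? (R? i) ∩? Q?)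
          (λ x≈y (r , q) → R-resp i x≈y r , Q-resp x≈y q)
          (λ x≈y (¬r , q) → ¬r ∘ R-resp i (sym x≈y) , Q-resp x≈y q)
          (λ {u} (r , q) → not-¬ (P.trans (rightDescent-∙s i u) (P.cong not r)) , Q-∙s q)
          (λ {u} (¬r , q) → P.trans (rightDescent-∙s i u) (P.cong not (¬-not ¬r)) , Q-∙s q))))

    length-noRightDescentIn : ∀ {k} {j : Fin k → Fin n} → IsCommutingFamily j →
      length (filter (noRightDescentIn? j) E) * 2 ^ k ≡ length E
    length-noRightDescentIn {zero} {j} _ = P.trans (*-identityʳ _)
      (P.cong length (filter-all (noRightDescentIn? j) {xs = E} (All.tabulate λ _ ())))
    length-noRightDescentIn {suc k} {j} family = begin-≡
      length (filter (noRightDescentIn? j) E) * 2 ^ suc k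
        ≡⟨ P.cong (λ xs → length xs * 2 ^ suc k) (filter-≐ (noRightDescentIn? j) (R? (j zero) ∩? Q?) (split , join) E) ⟩
      c * (2 * 2 ^ k)                    ≡⟨ *-assoc c 2 (2 ^ k) ⟨
      (c * 2) * 2 ^ k                    ≡⟨ P.cong (_* 2 ^ k) (P.trans (*-comm c 2) (P.cong (c +_) (+-identityʳ c))) ⟩
      (c + c) * 2 ^ k                    ≡⟨ P.cong (_* 2 ^ k) (length-filter-halves (j zero) Q? Q-resp Q-∙s) ⟨
      length (filter Q? E) * 2 ^ k       ≡⟨ length-noRightDescentIn (IsCommutingFamily-tail family) ⟩
      length E                           ∎-≡
      where
      open P.≡-Reasoning renaming (begin_ to begin-≡_; _∎ to _∎-≡)
      open IsCommutingFamily family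
      Q : U.Pred Carrier 0ℓ
      Q u = NoRightDescentIn u (λ p → j (suc p))
      Q? : U.Decidable Q
      Q? = noRightDescentIn? (λ p → j (suc p))
      Q-resp : ∀ {x y} → x ≈ y → Q x → Q y
      Q-resp x≈y q p = R-resp _ x≈y (q p)
      Q-∙s : ∀ {u} → Q u → Q (u ∙ s (j zero))
      Q-∙s q p = P.trans (rightDescent-∙s-commuting _ (commute zero (suc p)) (≢⇒≢ λ ())) (q p)
      c = length (filter (R? (j zero) ∩? Q?) E)
      split : ∀ {u} → NoRightDescentIn u j → (R (j zero) ∩ Q) u
      split noDesc = noDesc zero , λ p → noDesc (suc p)
      join : ∀ {u} → (R (j zero) ∩ Q) u → NoRightDescentIn u j
      join (r , _) zero = r
      join (_ , q) (suc p) = q p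

    noRightDescentIn-resp : ∀ {k} (j : Fin k → Fin n) {x y} → x ≈ y → NoRightDescentIn x j → NoRightDescentIn y j
    noRightDescentIn-resp j x≈y noDesc p = R-resp (j p) x≈y (noDesc p)

    block : Subset n → List (Carrier × Carrier)
    block J = map (λ u → u , u ∙ w₀ J) (filter (noRightDescentIn? (elements J)) E)

    booleanIntervals : List (Subset n) → List (Carrier × Carrier)
    booleanIntervals = concatMap block

    length-booleanIntervals : ∀ {k I} → All (IsIndependentSet k) I → length (booleanIntervals I) * 2 ^ k ≡ length I * length E
    length-booleanIntervals [] = P.refl
    length-booleanIntervals {k} {J ∷ I} (independent ∷ independents) = begin-≡
      length (block J ++ booleanIntervals I) * 2 ^ k                  ≡⟨ P.cong (_* 2 ^ k) (length-++ (block J)) ⟩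
      (length (block J) + length (booleanIntervals I)) * 2 ^ k        ≡⟨ *-distribʳ-+ (2 ^ k) (length (block J)) _ ⟩
      length (block J) * 2 ^ k + length (booleanIntervals I) * 2 ^ k  ≡⟨ P.cong₂ _+_ length-block (length-booleanIntervals independents) ⟩
      length E + length I * length E                                  ∎-≡
      where
      open P.≡-Reasoning renaming (begin_ to begin-≡_; _∎ to _∎-≡)
      length-block : length (block J) * 2 ^ k ≡ length E
      length-block = P.trans (P.cong (_* 2 ^ k) (length-map _ (filter (noRightDescentIn? (elements J)) E)))
        (P.subst (λ m → length (filter (noRightDescentIn? (elements J)) E) * 2 ^ m ≡ length E) (proj₁ independent)
          (length-noRightDescentIn (isCommutingFamily-elements independent)))

    booleanIntervals-counts : ∀ {k I} → CountsIndependentSets k I → CountsBooleanIntervals k (booleanIntervals I)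
    booleanIntervals-counts {k} {I} (I-unique , independents , I-complete) = unique , boolean , complete
      where
      Distinct : Carrier × Carrier → Carrier × Carrier → Set
      Distinct p q = ¬ (proj₁ p ≈ proj₁ q × proj₂ p ≈ proj₂ q)

      block-unique : ∀ J → AllPairs Distinct (block J)
      block-unique J = AllPairs.map⁺ (AllPairs.map (λ u≉u′ (u≈u′ , _) → u≉u′ u≈u′)
        (AllPairs.filter⁺ (noRightDescentIn? (elements J)) (proj₁ enumeration)))

      -- u is recovered from the pair, and then w₀ J determines J.
      blocks-distinct : ∀ {J J′} → IsIndependentSet k J → IsIndependentSet k J′ → J ≢ J′ →
        All (λ x → All (Distinct x) (block J′)) (block J)
      blocks-distinct {J} {J′} independent independent′ J≢J′ = All.map⁺ (All.tabulate λ {u} _ →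
        All.map⁺ (All.tabulate λ {u′} _ (u≈u′ , uw≈u′w′) → J≢J′ (w₀-injective independent independent′ (begin
          w₀ J                   ≈⟨ \\-leftDividesʳ u (w₀ J) ⟨
          u ⁻¹ ∙ (u ∙ w₀ J)      ≈⟨ ∙-cong (⁻¹-cong u≈u′) uw≈u′w′ ⟩
          u′ ⁻¹ ∙ (u′ ∙ w₀ J′)   ≈⟨ \\-leftDividesʳ u′ (w₀ J′) ⟩
          w₀ J′                  ∎))))

      unique : AllPairs Distinct (booleanIntervals I)
      unique = AllPairs.concat⁺ (All.map⁺ (All.tabulate λ {J} _ → block-unique J))
        (AllPairs.map⁺ (AllPairs-All⁺ blocks-distinct independents I-unique))

      boolean : All (λ p → IsBooleanInterval k (proj₁ p) (proj₂ p)) (booleanIntervals I)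
      boolean = All.concat⁺ (All.map⁺ (All.map (λ independent →
        All.map⁺ (All.map (isBooleanInterval-w₀ independent) (all-filter (noRightDescentIn? _) E))) independents))

      complete : ∀ u w → IsBooleanInterval k u w → Any (λ p → u ≈ proj₁ p × w ≈ proj₂ p) (booleanIntervals I)
      complete u w interval = Any.concat⁺ (Any.map⁺ (Any.map (λ J≡J′ → P.subst (λ J′ → Any _ (block J′)) J≡J′ inBlock)
        (I-complete J independent)))
        where
        standard = boolean⇒standard interval
        J = proj₁ standard
        independent : IsIndependentSet k J
        independent = proj₁ (proj₂ standard)
        u∈ : Any (u ≈_) (filter (noRightDescentIn? (elements J)) E)
        u∈ = ∈-filterˢ⁺ setoid (noRightDescentIn? (elements J)) (noRightDescentIn-resp (elements J))
          (proj₂ enumeration u) (proj₁ (proj₂ (proj₂ standard)))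
        inBlock : Any (λ p → u ≈ proj₁ p × w ≈ proj₂ p) (block J)
        inBlock = Any.map⁺ (Any.map (λ u≈u′ → u≈u′ , trans (proj₂ (proj₂ (proj₂ standard))) (∙-congʳ u≈u′)) u∈)

corollary1p3 : (W : Group 0ℓ 0ℓ) (n : ℕ) (s : Fin n → Group.Carrier W) →
    Cox.IsCoxeterSystem W s →
    Decidable (Group._≈_ W) →
    (E : List (Group.Carrier W)) → Cox.IsEnumeration W s E →
    (k : ℕ) →
    Σ (List (Subset n)) λ I → Σ (List (Group.Carrier W × Group.Carrier W)) λ B →
      Cox.CountsIndependentSets W s k I × Cox.CountsBooleanIntervals W s k B ×
      length B * 2 ^ k ≡ length I * length E
corollary1p3 W n s cox _≈?_ E enumeration k =
  independentSets k , booleanIntervals enumeration (independentSets k) ,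
  independentSets-counts k , booleanIntervals-counts enumeration (independentSets-counts k) ,
  length-booleanIntervals enumeration (proj₁ (proj₂ (independentSets-counts k)))
  where open Coxeter W s cox _≈?_
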